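{- Let $k\ge i\ge1$. An overpartition $\lambda$ is counted by $O_{k,i}(n)$ (with $n=|\lambda|$) if and only if $f_{\overline1}(\lambda)+f_2(\lambda)\le i-1$ and every mark in the Göllnitz–Gordon marking of $\lambda$ is at most $k-1$.
   Context: An overpartition of $n$ is a partition of $n$ in which the first occurrence of each part size may be overlined. Parts are ordered by $\overline1<1<\overline2<2<\overline3<3<\cdots$, and an overpartition is written $\lambda=(\lambda_1,\dots,\lambda_\ell)$ with $\lambda_1\le\cdots\le\lambda_\ell$ in this order; $|\lambda_j|$ is the numerical size of a part and $|\lambda|=\sum_j|\lambda_j|$. For $t\ge1$, $f_t(\lambda)$ (resp. $f_{\overline t}(\lambda)$) is the number of non-overlined (resp. overlined) parts equal to $t$; $f_0=f_{\overline0}=0$. $O_{k,i}(n)$ is the number of overpartitions $\lambda$ of $n$ with (1) $f_{\overline1}(\lambda)+f_2(\lambda)\le i-1$; (2) $f_{\overline{2t}}(\lambda)+f_{2t}(\lambda)+f_{\overline{2t+1}}(\lambda)+f_{2t+2}(\lambda)\le k-1$ for every $t\ge0$; (3) for every $t\ge0$, if $f_{2t+1}(\lambda)\ge1$ then $f_{2t+2}(\lambda)\le k-2$. Göllnitz–Gordon marking: marks (positive integers) are assigned to $\lambda_1,\dots,\lambda_\ell$ in this order; $\lambda_1$ gets mark $1$. For $p>1$: (a) a non-overlined odd $\lambda_p$ gets mark $1$; (b) an overlined even $\lambda_p$ gets mark $1$; (c) an overlined odd $\lambda_p$ gets the least positive integer not used as the mark of any $\lambda_j$ ($j<p$) with $|\lambda_p|-|\lambda_j|=1$;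 (d) if $\lambda_p=2t+2$ is non-overlined even, let $f$ be the least positive integer not used as the mark of any $\lambda_j$ ($j<p$) with $|\lambda_p|-|\lambda_j|\le2$, and $g$ the least positive integer used as the mark of some $\lambda_j$ ($j<p$) with $|\lambda_p|-|\lambda_j|=2$ ($g=0$ if none). If simultaneously (i) $g\ge2$, (ii) the mark of $\lambda_{p-1}$ is $g-1$, (iii) a non-overlined $2t+1$ or an $\overline{2t+2}$ occurs in $\lambda$, (iv) $\overline{2t+1}$ does not occur in $\lambda$, then $\lambda_p$ gets mark $g$; otherwise it gets mark $f$. -}

module Defs where

open import Data.Nat using (ℕ; zero; suc; _+_; _*_; _∸_; _≤_; _<_; _≡ᵇ_; _≤ᵇ_; _⊓_)
open import Data.Bool using (Bool; true; false; if_then_else_; _∧_; _∨_; not)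
open import Data.List using (List; []; _∷_; length; map; filter)
open import Data.List.Relation.Unary.Linked using (Linked)
open import Data.List.Relation.Unary.All using (All)
open import Data.Product using (_×_; _,_; proj₁; proj₂)

-- A part is (numerical size, overlined?).  (t , true) is the overlined part
-- t̄, (t , false) the non-overlined part t.
Part : Set
Part = ℕ × Bool

size : Part → ℕ
size = proj₁

overlined : Part → Bool
overlined = proj₂

-- Position in the order 1̄ < 1 < 2̄ < 2 < 3̄ < 3 < ⋯
key : Part → ℕ
key (s , b) = 2 * s ∸ (if b then 1 else 0)

_==B_ : Bool → Bool → Bool
true  ==B true  = true
false ==B false = true
_     ==B _     = false

samePart : Part → Part → Bool
samePart (s , b) (s' , b') = (s ≡ᵇ s') ∧ (b ==B b')

count : Part → List Part → ℕ
count p []       = 0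
count p (q ∷ qs) = if samePart p q then suc (count p qs) else count p qs

occurs : Part → List Part → Bool
occurs p []       = false
occurs p (q ∷ qs) = samePart p q ∨ occurs p qs

f : ℕ → List Part → ℕ
f t μ = count (t , false) μ

f̄ : ℕ → List Part → ℕ
f̄ t μ = count (t , true) μ

-- An overpartition written (λ₁,…,λ_ℓ) with λ₁ ≤ ⋯ ≤ λ_ℓ in the order above:
-- all parts positive, listed in nondecreasing order, and each overlined
-- part size occurs at most once.
IsOverpartition : List Part → Set
IsOverpartition μ =
  All (λ p → 1 ≤ size p) μ
  × Linked (λ p q → key p ≤ key q) μ
  × (∀ t → f̄ t μ ≤ 1)

weight : List Part → ℕ
weight []       = 0
weight (p ∷ ps) = size p + weight ps

-- λ is counted by O_{k,i}(|λ|).  (Conditions written additively, so that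
-- "≤ i-1", "≤ k-1", "≤ k-2" carry no truncated subtraction.)
CountedO : ℕ → ℕ → List Part → Set
CountedO k i μ =
  (f̄ 1 μ + f 2 μ + 1 ≤ i)
  × (∀ t → f̄ (2 * t) μ + f (2 * t) μ + f̄ (2 * t + 1) μ + f (2 * t + 2) μ + 1 ≤ k)
  × (∀ t → 1 ≤ f (2 * t + 1) μ → f (2 * t + 2) μ + 2 ≤ k)

isEven : ℕ → Bool
isEven zero          = true
isEven (suc zero)    = false
isEven (suc (suc n)) = isEven n

elem : ℕ → List ℕ → Bool
elem m []       = false
elem m (x ∷ xs) = (m ≡ᵇ x) ∨ elem m xs

firstFrom : ℕ → ℕ → List ℕ → ℕ
firstFrom m zero     xs = m
firstFrom m (suc fu) xs = if elem m xs then firstFrom (suc m) fu xs else m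

-- least positive integer not in xs (fuel length xs suffices)
leastUnused : List ℕ → ℕ
leastUnused xs = firstFrom 1 (length xs) xs

-- least positive integer in xs, or 0 if there is none
leastUsed : List ℕ → ℕ
leastUsed []       = 0
leastUsed (zero ∷ xs)  = leastUsed xs
leastUsed (suc x ∷ xs) with leastUsed xs
... | zero  = suc x
... | suc y = suc x ⊓ suc y

marksWhere : (ℕ → Bool) → List (Part × ℕ) → List ℕ
marksWhere P []              = []
marksWhere P ((q , m) ∷ qs) = if P (size q) then m ∷ marksWhere P qs else marksWhere P qs

-- mark of the current part λ_p, given the whole overpartition μ and the
-- earlier parts with their marks, most recent (λ_{p-1}) first.
markOf : List Part → List (Part × ℕ) → Part → ℕ
markOf μ [] p = 1
markOf μ prev@((_ , mprev) ∷ _) (s , false) =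
  if not (isEven s) then 1                                   -- (a)
  else                                                       -- (d)
    (let fv = leastUnused (marksWhere (λ sj → s ≤ᵇ sj + 2) prev)
         gv = leastUsed   (marksWhere (λ sj → s ≡ᵇ sj + 2) prev)
         cond = (2 ≤ᵇ gv)
                ∧ (mprev ≡ᵇ gv ∸ 1)
                ∧ (occurs (s ∸ 1 , false) μ ∨ occurs (s , true) μ)
                ∧ not (occurs (s ∸ 1 , true) μ)
     in if cond then gv else fv)
markOf μ prev@(_ ∷ _) (s , true) =
  if isEven s then 1                                         -- (b)
  else leastUnused (marksWhere (λ sj → s ≡ᵇ sj + 1) prev)    -- (c)

markGo : List Part → List (Part × ℕ) → List Part → List ℕ
markGo μ prev []       = []
markGo μ prev (p ∷ ps) =
  markOf μ prev p ∷ markGo μ ((p , markOf μ prev p) ∷ prev) ps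

marks : List Part → List ℕ
marks μ = markGo μ [] μ

module Submission where

-- The marking is computed from left to right; we follow it along a trace (the
-- parts already marked, with their marks, most recent first).  For every u we
-- look at the window of parts 2̄u, 2u, ‾2u+1, 2u+1, ‾2u+2, 2u+2 and maintain
-- along the trace an invariant 'Inv u' whose core is
--   * a list of pairwise distinct marks of window parts whose length is the
--     window count W_u = f_{2̄u} + f_{2u} + f_{‾2u+1} + f_{2u+2} of condition (2);
--   * once a part 2u+1 has been marked, a list of f_{2u+2} + 1 distinct marks
--     of window parts (condition (3));
-- the other fields of 'Inv' keep track of the exceptional rule (d).
-- Backward direction: if all marks are ≤ k-1, these lists consist of distinct
-- numbers in [1,k-1], and the pigeonhole principle gives (2) and (3).
-- Forward direction: the same step lemmas show that each new mark is at most
-- the current window count, an earlier mark, or f_{2u+2} + 1 in the presence of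
-- a 2u+1 or ‾2u+2; conditions (2) and (3) bound each of these by k-1.

open import Defs
open import Data.Nat using (ℕ; zero; suc; _+_; _*_; _∸_; _≤_; _<_; _≡ᵇ_; _≤ᵇ_; z≤n; s≤s)
open import Data.Nat.Properties
open import Data.Bool using (Bool; true; false; if_then_else_; _∧_; _∨_; not; T)
import Data.Bool as Bool
open import Data.Bool.Properties using (∧-conicalˡ; ∧-conicalʳ; ∨-zeroʳ)
open import Data.List using (List; []; _∷_; length; map; _++_; applyUpTo)
open import Data.List.Properties using (length-++-sucʳ; length-applyUpTo)
open import Data.List.Membership.Propositional using (_∈_; _∉_)
open import Data.List.Membership.DecPropositional _≟_ using (_∈?_)
open import Data.List.Membership.Propositional.Properties
  using (∈-∃++; ∈-++⁻; ∈-++⁺ˡ; ∈-++⁺ʳ; ∈-applyUpTo⁺; ∈-applyUpTo⁻; ∉[])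
open import Data.List.Relation.Binary.Subset.Propositional using (_⊆_)
open import Data.List.Relation.Unary.All as All using (All; []; _∷_)
open import Data.List.Relation.Unary.All.Properties using (¬Any⇒All¬)
open import Data.List.Relation.Unary.Any using (here; there)
open import Data.List.Relation.Unary.Linked using (Linked; []; [-]; _∷_)
open import Data.List.Relation.Unary.Unique.Propositional using (Unique; []; _∷_)
open import Data.List.Relation.Unary.Unique.Propositional.Properties using (applyUpTo⁺₁)
open import Data.Product using (_×_; _,_; proj₁; proj₂; Σ)
open import Data.Product.Properties using (≡-dec)
open import Data.Sum using (_⊎_; inj₁; inj₂; [_,_]′)
import Data.Sum as Sum
open import Data.Empty using (⊥; ⊥-elim)
open import Function using (_∘_)
open import Function.Bundles using (_⇔_; mk⇔)
open import Relation.Nullary using (¬_; yes; no; Dec)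
open import Relation.Binary.Definitions using (tri<; tri≈; tri>)
open import Relation.Binary.PropositionalEquality

infixr 5 _∷ᵘ_
_∷ᵘ_ : {x : ℕ} {xs : List ℕ} → x ∉ xs → Unique xs → Unique (x ∷ xs)
_∷ᵘ_ {xs = xs} x∉xs uxs = ¬Any⇒All¬ xs x∉xs ∷ uxs

unique-⊆-length : {xs ys : List ℕ} → Unique xs → xs ⊆ ys → length xs ≤ length ys
unique-⊆-length {[]} _ _ = z≤n
unique-⊆-length {x ∷ xs} (x≢xs ∷ uxs) xs⊆ys with ∈-∃++ (xs⊆ys (here refl))
... | ys₁ , ys₂ , refl =
  ≤-trans (s≤s (unique-⊆-length uxs xs⊆ys₁ys₂)) (≤-reflexive (sym (length-++-sucʳ ys₁ x ys₂)))
  where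
  xs⊆ys₁ys₂ : xs ⊆ ys₁ ++ ys₂
  xs⊆ys₁ys₂ {v} v∈xs with ∈-++⁻ ys₁ (xs⊆ys (there v∈xs))
  ... | inj₁ v∈ys₁         = ∈-++⁺ˡ v∈ys₁
  ... | inj₂ (here refl)   = ⊥-elim (All.lookup x≢xs v∈xs refl)
  ... | inj₂ (there v∈ys₂) = ∈-++⁺ʳ ys₁ v∈ys₂

oneTo : ℕ → List ℕ
oneTo = applyUpTo suc

oneTo-unique : ∀ n → Unique (oneTo n)
oneTo-unique n = applyUpTo⁺₁ suc n (λ i<j _ eq → <-irrefl (suc-injective eq) i<j)

∈-oneTo⁺ : ∀ {v n} → 1 ≤ v → v ≤ n → v ∈ oneTo n
∈-oneTo⁺ {suc v} _ v<n = ∈-applyUpTo⁺ suc v<n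

∈-oneTo⁻ : ∀ {v n} → v ∈ oneTo n → 1 ≤ v × v ≤ n
∈-oneTo⁻ v∈ with ∈-applyUpTo⁻ suc v∈
... | _ , i<n , refl = s≤s z≤n , i<n

pigeonhole : ∀ n xs → Unique xs → (∀ v → v ∈ xs → 1 ≤ v × v ≤ n) → length xs ≤ n
pigeonhole n xs uxs inRange =
  ≤-trans (unique-⊆-length uxs (λ {v} v∈ → let (1≤v , v≤n) = inRange v v∈ in ∈-oneTo⁺ 1≤v v≤n))
          (≤-reflexive (length-applyUpTo suc n))

covering : ∀ n xs → (∀ v → 1 ≤ v → v ≤ n → v ∈ xs) → n ≤ length xs
covering n xs covers =
  ≤-trans (≤-reflexive (sym (length-applyUpTo suc n)))
          (unique-⊆-length (oneTo-unique n) (λ v∈ → let (1≤v , v≤n) = ∈-oneTo⁻ v∈ in covers _ 1≤v v≤n))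

covering-below : ∀ m D → 1 ≤ m → (∀ v → 1 ≤ v → v < m → v ∈ D) → m ≤ suc (length D)
covering-below (suc m) D _ covers = s≤s (covering m D (λ v 1≤v v≤m → covers v 1≤v (s≤s v≤m)))

true≢false : true ≢ false
true≢false ()

false≢true : false ≢ true
false≢true ()

T⇒≡true : ∀ {b} → T b → b ≡ true
T⇒≡true {true} _ = refl

≡true⇒T : ∀ {b} → b ≡ true → T b
≡true⇒T refl = _

≡ᵇ-refl : ∀ n → (n ≡ᵇ n) ≡ true
≡ᵇ-refl n = T⇒≡true (≡⇒≡ᵇ n n refl)

elem⇒∈ : ∀ v xs → elem v xs ≡ true → v ∈ xs
elem⇒∈ v (x ∷ xs) e with v ≡ᵇ x in eq
... | true  = here (≡ᵇ⇒≡ v x (≡true⇒T eq))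
... | false = there (elem⇒∈ v xs e)

∈⇒elem : ∀ {v xs} → v ∈ xs → elem v xs ≡ true
∈⇒elem {v} (here refl) rewrite ≡ᵇ-refl v = refl
∈⇒elem {v} {x ∷ _} (there v∈) rewrite ∈⇒elem v∈ = ∨-zeroʳ (v ≡ᵇ x)

firstFrom-≥ : ∀ m fu xs → m ≤ firstFrom m fu xs
firstFrom-≥ m zero xs = ≤-refl
firstFrom-≥ m (suc fu) xs with elem m xs
... | true  = ≤-trans (n≤1+n m) (firstFrom-≥ (suc m) fu xs)
... | false = ≤-refl

firstFrom-skips : ∀ m fu xs v → m ≤ v → v < firstFrom m fu xs → v ∈ xs
firstFrom-skips m zero xs v m≤v v< = ⊥-elim (<-irrefl refl (≤-<-trans m≤v v<))
firstFrom-skips m (suc fu) xs v m≤v v< with elem m xs in eq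
... | false = ⊥-elim (<-irrefl refl (≤-<-trans m≤v v<))
... | true with m≤n⇒m<n∨m≡n m≤v
...   | inj₁ m<v  = firstFrom-skips (suc m) fu xs v m<v v<
...   | inj₂ refl = elem⇒∈ m xs eq

firstFrom-stops : ∀ m fu xs → firstFrom m fu xs ≡ m + fu ⊎ firstFrom m fu xs ∉ xs
firstFrom-stops m zero xs = inj₁ (sym (+-identityʳ m))
firstFrom-stops m (suc fu) xs with elem m xs in eq
... | false = inj₂ (λ m∈ → true≢false (trans (sym (∈⇒elem m∈)) eq))
... | true with firstFrom-stops (suc m) fu xs
...   | inj₁ e = inj₁ (trans e (sym (+-suc m fu)))
...   | inj₂ n = inj₂ n

leastUnused-pos : ∀ xs → 1 ≤ leastUnused xs
leastUnused-pos xs = firstFrom-≥ 1 (length xs) xs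

leastUnused-below : ∀ xs v → 1 ≤ v → v < leastUnused xs → v ∈ xs
leastUnused-below xs = firstFrom-skips 1 (length xs) xs

-- The least unused number is unused: the fuel |xs| cannot run out, since
-- [1, |xs| + 1] does not fit into xs.
leastUnused-∉ : ∀ xs → leastUnused xs ∉ xs
leastUnused-∉ xs m∈ with firstFrom-stops 1 (length xs) xs
... | inj₂ m∉ = m∉ m∈
... | inj₁ m≡ = <-irrefl refl (subst (_≤ length xs) m≡ (covering (leastUnused xs) xs covers))
  where
  covers : ∀ v → 1 ≤ v → v ≤ leastUnused xs → v ∈ xs
  covers v 1≤v v≤ with m≤n⇒m<n∨m≡n v≤
  ... | inj₁ v< = leastUnused-below xs v 1≤v v<
  ... | inj₂ refl = m∈

leastUsed-0-or-∈ : ∀ xs → leastUsed xs ≡ 0 ⊎ leastUsed xs ∈ xs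
leastUsed-0-or-∈ [] = inj₁ refl
leastUsed-0-or-∈ (zero ∷ xs) = Sum.map₂ there (leastUsed-0-or-∈ xs)
leastUsed-0-or-∈ (suc x ∷ xs) with leastUsed xs | leastUsed-0-or-∈ xs
... | zero  | _ = inj₂ (here refl)
... | suc y | inj₂ y∈ with ⊓-sel (suc x) (suc y)
...   | inj₁ e = inj₂ (subst (_∈ (suc x ∷ xs)) (sym e) (here refl))
...   | inj₂ e = inj₂ (subst (_∈ (suc x ∷ xs)) (sym e) (there y∈))

leastUsed-pos : ∀ xs v → v ∈ xs → 1 ≤ v → 1 ≤ leastUsed xs
leastUsed-pos (zero ∷ xs) v (here refl) ()
leastUsed-pos (zero ∷ xs) v (there v∈) 1≤v = leastUsed-pos xs v v∈ 1≤v
leastUsed-pos (suc x ∷ xs) v _ _ with leastUsed xs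
... | zero  = s≤s z≤n
... | suc _ = s≤s z≤n

leastUsed-≤ : ∀ xs v → v ∈ xs → 1 ≤ v → leastUsed xs ≤ v
leastUsed-≤ (zero ∷ xs) v (here refl) ()
leastUsed-≤ (zero ∷ xs) v (there v∈) 1≤v = leastUsed-≤ xs v v∈ 1≤v
leastUsed-≤ (suc x ∷ xs) v v∈ 1≤v with leastUsed xs | leastUsed-≤ xs | leastUsed-pos xs
leastUsed-≤ (suc x ∷ xs) v (here refl) _   | zero  | _   | _   = ≤-refl
leastUsed-≤ (suc x ∷ xs) v (there v∈) 1≤v  | zero  | _   | pos = ⊥-elim (<-irrefl refl (pos v v∈ 1≤v))
leastUsed-≤ (suc x ∷ xs) v (here refl) _   | suc y | _   | _   = m⊓n≤m (suc x) (suc y)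
leastUsed-≤ (suc x ∷ xs) v (there v∈) 1≤v  | suc y | ≤v  | _   = ≤-trans (m⊓n≤n (suc x) (suc y)) (≤v v v∈ 1≤v)

∧-true : ∀ {a b} → a ≡ true → b ≡ true → a ∧ b ≡ true
∧-true refl refl = refl

∨-trueˡ : ∀ {a} b → a ≡ true → a ∨ b ≡ true
∨-trueˡ b refl = refl

∨-trueʳ : ∀ a {b} → b ≡ true → a ∨ b ≡ true
∨-trueʳ a refl = ∨-zeroʳ a

∨≡true⇒ : ∀ a b → a ∨ b ≡ true → a ≡ true ⊎ b ≡ true
∨≡true⇒ true  b _ = inj₁ refl
∨≡true⇒ false b e = inj₂ e

not≡true⇒ : ∀ a → not a ≡ true → a ≡ false
not≡true⇒ false _ = refl

not-false : ∀ {a} → a ≡ false → not a ≡ true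
not-false refl = refl

≤⇒≤ᵇ≡true : ∀ {m n} → m ≤ n → (m ≤ᵇ n) ≡ true
≤⇒≤ᵇ≡true h = T⇒≡true (≤⇒≤ᵇ h)

≤ᵇ≡true⇒≤ : ∀ {m n} → (m ≤ᵇ n) ≡ true → m ≤ n
≤ᵇ≡true⇒≤ {m} {n} e = ≤ᵇ⇒≤ m n (≡true⇒T e)

≡⇒≡ᵇ≡true : ∀ {m n} → m ≡ n → (m ≡ᵇ n) ≡ true
≡⇒≡ᵇ≡true {m} {n} h = T⇒≡true (≡⇒≡ᵇ m n h)

≡ᵇ≡true⇒≡ : ∀ {m n} → (m ≡ᵇ n) ≡ true → m ≡ n
≡ᵇ≡true⇒≡ {m} {n} e = ≡ᵇ⇒≡ m n (≡true⇒T e)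

≢⇒≡ᵇ≡false : ∀ {m n} → m ≢ n → (m ≡ᵇ n) ≡ false
≢⇒≡ᵇ≡false {m} {n} m≢n with m ≡ᵇ n in eq
... | true  = ⊥-elim (m≢n (≡ᵇ≡true⇒≡ eq))
... | false = refl

+1≤suc⇒≤ : ∀ {d n} → d + 1 ≤ suc n → d ≤ n
+1≤suc⇒≤ {d} {n} h = ≤-pred (subst (_≤ suc n) (+-comm d 1) h)

≤⇒+1≤suc : ∀ {d n} → d ≤ n → d + 1 ≤ suc n
≤⇒+1≤suc {d} {n} h = subst (_≤ suc n) (+-comm 1 d) (s≤s h)

n∸1<n : ∀ {n} → 1 ≤ n → n ∸ 1 < n
n∸1<n {suc n} _ = ≤-refl

<⇒≤∸1 : ∀ {v g} → v < g → v ≤ g ∸ 1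
<⇒≤∸1 {g = suc g} (s≤s v≤g) = v≤g

2≤⇒≢1 : ∀ {g} → 2 ≤ g → g ≢ 1
2≤⇒≢1 (s≤s ()) refl

window-second-bound : ∀ {a b c d k} → a + b + c + d + 1 ≤ k → 1 ≤ a → b + 2 ≤ k
window-second-bound {a} {b} {c} {d} {k} h 1≤a = begin
  b + 2                    ≡⟨ +-comm b 2 ⟩
  suc (1 + b)              ≤⟨ s≤s (+-monoˡ-≤ b 1≤a) ⟩
  suc (a + b)              ≤⟨ s≤s (≤-trans (m≤m+n (a + b) c) (m≤m+n (a + b + c) d)) ⟩
  suc (a + b + c + d)      ≡⟨ +-comm 1 (a + b + c + d) ⟩
  a + b + c + d + 1        ≤⟨ h ⟩
  k                        ∎
  where open ≤-Reasoning

+2≤⇒2≤ : ∀ {x k} → x + 2 ≤ k → 2 ≤ k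
+2≤⇒2≤ {x} h = ≤-trans (m≤n+m 2 x) h

≤+1-bound : ∀ {m x k} → m ≤ x + 1 → x + 2 ≤ k → m + 1 ≤ k
≤+1-bound {m} {x} m≤ h = ≤-trans (+-monoˡ-≤ 1 m≤) (≤-trans (≤-reflexive (+-assoc x 1 1)) h)

_≟ₚ_ : (a b : Part) → Dec (a ≡ b)
_≟ₚ_ = ≡-dec _≟_ Bool._≟_

==B-refl : ∀ b → (b ==B b) ≡ true
==B-refl true  = refl
==B-refl false = refl

==B⇒≡ : ∀ b b' → (b ==B b') ≡ true → b ≡ b'
==B⇒≡ true  true  _ = refl
==B⇒≡ false false _ = refl

samePart-refl : ∀ a → samePart a a ≡ true
samePart-refl (s , b) rewrite ==B-refl b | ≡ᵇ-refl s = refl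

samePart⇒≡ : ∀ a b → samePart a b ≡ true → a ≡ b
samePart⇒≡ (s , b) (s' , b') e with s ≡ᵇ s' in eq
... | true = cong₂ _,_ (≡ᵇ⇒≡ s s' (≡true⇒T eq)) (==B⇒≡ b b' e)

samePart-≢ : ∀ a b → a ≢ b → samePart a b ≡ false
samePart-≢ a b a≢b with samePart a b in eq
... | true  = ⊥-elim (a≢b (samePart⇒≡ a b eq))
... | false = refl

count-here : ∀ a xs → count a (a ∷ xs) ≡ suc (count a xs)
count-here a xs rewrite samePart-refl a = refl

count-there : ∀ a b xs → a ≢ b → count a (b ∷ xs) ≡ count a xs
count-there a b xs a≢b rewrite samePart-≢ a b a≢b = refl

count-pos⇒∈ : ∀ a xs → 1 ≤ count a xs → a ∈ xs
count-pos⇒∈ a (q ∷ xs) pos with a ≟ₚ q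
... | yes refl = here refl
... | no a≢q  = there (count-pos⇒∈ a xs (subst (1 ≤_) (count-there a q xs a≢q) pos))

∈⇒count-pos : ∀ a xs → a ∈ xs → 1 ≤ count a xs
∈⇒count-pos a (q ∷ xs) a∈ with a ≟ₚ q
... | yes refl rewrite count-here a xs = s≤s z≤n
∈⇒count-pos a (q ∷ xs) (here refl) | no a≢q = ⊥-elim (a≢q refl)
∈⇒count-pos a (q ∷ xs) (there a∈) | no a≢q rewrite count-there a q xs a≢q = ∈⇒count-pos a xs a∈

occurs⇒∈ : ∀ a xs → occurs a xs ≡ true → a ∈ xs
occurs⇒∈ a (q ∷ xs) e with samePart a q in eq
... | true  = here (samePart⇒≡ a q eq)
... | false = there (occurs⇒∈ a xs e)

∈⇒occurs : ∀ a xs → a ∈ xs → occurs a xs ≡ true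
∈⇒occurs a (q ∷ xs) (here refl) rewrite samePart-refl a = refl
∈⇒occurs a (q ∷ xs) (there a∈) rewrite ∈⇒occurs a xs a∈ = ∨-zeroʳ (samePart a q)

2*suc : ∀ t → 2 * suc t ≡ suc (suc (2 * t))
2*suc t rewrite +-suc t (t + 0) = refl

isEven-2* : ∀ t → isEven (2 * t) ≡ true
isEven-2* zero    = refl
isEven-2* (suc t) rewrite 2*suc t = isEven-2* t

isEven-suc : ∀ n → isEven (suc n) ≡ not (isEven n)
isEven-suc zero = refl
isEven-suc (suc n) rewrite isEven-suc n with isEven n
... | true  = refl
... | false = refl

isEven-2*+1 : ∀ t → isEven (2 * t + 1) ≡ false
isEven-2*+1 t rewrite +-comm (2 * t) 1 | isEven-suc (2 * t) | isEven-2* t = refl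

isEven-2*+2 : ∀ t → isEven (2 * t + 2) ≡ true
isEven-2*+2 t rewrite +-comm (2 * t) 2 = isEven-2* t

parity : ∀ s → Σ ℕ λ t → s ≡ 2 * t ⊎ s ≡ 2 * t + 1
parity zero = 0 , inj₁ refl
parity (suc zero) = 0 , inj₂ refl
parity (suc (suc s)) with parity s
... | t , inj₁ refl = suc t , inj₁ (sym (2*suc t))
... | t , inj₂ refl = suc t , inj₂ (sym (cong (_+ 1) (2*suc t)))

2u+1≡suc : ∀ u → 2 * u + 1 ≡ suc (2 * u)
2u+1≡suc u = +-comm (2 * u) 1

2u+2≡suc : ∀ u → 2 * u + 2 ≡ suc (2 * u + 1)
2u+2≡suc u = +-suc (2 * u) 1

2u+2≡2*suc : ∀ u → 2 * u + 2 ≡ 2 * suc u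
2u+2≡2*suc u rewrite 2*suc u = +-comm (2 * u) 2

2u+2∸1 : ∀ u → 2 * u + 2 ∸ 1 ≡ 2 * u + 1
2u+2∸1 u rewrite +-suc (2 * u) 1 = refl

<01 : ∀ u → 2 * u < 2 * u + 1
<01 u = ≤-reflexive (sym (2u+1≡suc u))

<12 : ∀ u → 2 * u + 1 < 2 * u + 2
<12 u = ≤-reflexive (sym (2u+2≡suc u))

<02 : ∀ u → 2 * u < 2 * u + 2
<02 u = <-trans (<01 u) (<12 u)

≢01 : ∀ u → 2 * u ≢ 2 * u + 1
≢01 u = <⇒≢ (<01 u)

≢12 : ∀ u → 2 * u + 1 ≢ 2 * u + 2
≢12 u = <⇒≢ (<12 u)

≢02 : ∀ u → 2 * u ≢ 2 * u + 2
≢02 u = <⇒≢ (<02 u)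

1≤2u+1 : ∀ u → 1 ≤ 2 * u + 1
1≤2u+1 u = ≤-trans (s≤s z≤n) (≤-reflexive (sym (2u+1≡suc u)))

1≤2u+2 : ∀ u → 1 ≤ 2 * u + 2
1≤2u+2 u = ≤-trans (1≤2u+1 u) (<⇒≤ (<12 u))

size-≢ : ∀ {a b : Part} → size a ≢ size b → a ≢ b
size-≢ ne e = ne (cong proj₁ e)

overlined-≢ : ∀ {a b : Part} → overlined a ≢ overlined b → a ≢ b
overlined-≢ ne e = ne (cong proj₂ e)

key-≤-2* : ∀ s b → key (s , b) ≤ 2 * s
key-≤-2* s false = ≤-refl
key-≤-2* s true  = m∸n≤m (2 * s) 1

2*-≤-suc-key : ∀ s b → 2 * s ≤ suc (key (s , b))
2*-≤-suc-key s false = n≤1+n _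
2*-≤-suc-key s true  = m≤n+m∸n (2 * s) 1

half-≤ : ∀ s s' → 2 * s ≤ suc (2 * s') → s ≤ s'
half-≤ zero s' _ = z≤n
half-≤ (suc a) zero h rewrite 2*suc a with h
... | s≤s ()
half-≤ (suc a) (suc b) h rewrite 2*suc a | 2*suc b = s≤s (half-≤ a b (≤-pred (≤-pred h)))

key-≤⇒size-≤ : ∀ q p → key q ≤ key p → size q ≤ size p
key-≤⇒size-≤ (s , b) (s' , b') h =
  half-≤ s s' (≤-trans (2*-≤-suc-key s b) (s≤s (≤-trans h (key-≤-2* s' b'))))

size-<⇒key-< : ∀ q p → size q < size p → key q < key p
size-<⇒key-< (s , b) (suc t , b') (s≤s h) =
  ≤-trans (s≤s (key-≤-2* s b)) (≤-trans (s≤s (*-monoʳ-≤ 2 h)) (2*t<key t b'))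
  where
  2*t<key : ∀ t b → suc (2 * t) ≤ key (suc t , b)
  2*t<key t false rewrite +-suc t (t + 0) = n≤1+n _
  2*t<key t true  rewrite +-suc t (t + 0) = ≤-refl

overlined-< : ∀ s → 1 ≤ s → key (s , true) < key (s , false)
overlined-< (suc t) _ rewrite 2*suc t = ≤-refl

≤-overlined⇒overlined : ∀ s b → 1 ≤ s → key (s , b) ≤ key (s , true) → b ≡ true
≤-overlined⇒overlined s true  _ _ = refl
≤-overlined⇒overlined s false 1≤s h = ⊥-elim (<-irrefl refl (<-≤-trans (overlined-< s 1≤s) h))

-- The parts already marked, each with its mark, most recent first.
Trace : Set
Trace = List (Part × ℕ)

parts : Trace → List Part
parts = map proj₁

tcount : Part → Trace → ℕ
tcount a P = count a (parts P)

-- Mark and key of the most recent part (0 for the empty trace).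
headMark : Trace → ℕ
headMark []            = 0
headMark ((_ , m) ∷ _) = m

headKey : Trace → ℕ
headKey []            = 0
headKey ((q , _) ∷ _) = key q

-- The overpartition is recovered by putting the traced parts back in front
-- of the parts still to be marked.
rebuild : Trace → List Part → List Part
rebuild []            ps = ps
rebuild ((q , m) ∷ P) ps = rebuild P (q ∷ ps)

tcount-here : ∀ a m P → tcount a ((a , m) ∷ P) ≡ suc (tcount a P)
tcount-here a m P = count-here a (parts P)

tcount-there : ∀ a b m P → a ≢ b → tcount a ((b , m) ∷ P) ≡ tcount a P
tcount-there a b m P a≢b = count-there a b (parts P) a≢b

tcount-mono : ∀ a P p m → tcount a P ≤ tcount a ((p , m) ∷ P)
tcount-mono a P p m with a ≟ₚ p
... | yes refl rewrite tcount-here a m P = n≤1+n _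
... | no a≢p  rewrite tcount-there a p m P a≢p = ≤-refl

tcount-pos⇒∈ : ∀ a P → 1 ≤ tcount a P → Σ ℕ λ m → (a , m) ∈ P
tcount-pos⇒∈ a ((q , m) ∷ P) pos with a ≟ₚ q
... | yes refl = m , here refl
... | no a≢q with tcount-pos⇒∈ a P (subst (1 ≤_) (tcount-there a q m P a≢q) pos)
...   | m' , a∈ = m' , there a∈

∈⇒tcount-pos : ∀ a m P → (a , m) ∈ P → 1 ≤ tcount a P
∈⇒tcount-pos a m ((q , m') ∷ P) a∈ with a ≟ₚ q
... | yes refl rewrite tcount-here a m' P = s≤s z≤n
∈⇒tcount-pos a m ((q , m') ∷ P) (here refl) | no a≢q = ⊥-elim (a≢q refl)
∈⇒tcount-pos a m ((q , m') ∷ P) (there a∈) | no a≢q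
  rewrite tcount-there a q m' P a≢q = ∈⇒tcount-pos a m P a∈

tcount-zero : ∀ a P → (∀ m → (a , m) ∉ P) → tcount a P ≡ 0
tcount-zero a P absent with tcount a P in eq
... | zero  = refl
... | suc _ with tcount-pos⇒∈ a P (subst (1 ≤_) (sym eq) (s≤s z≤n))
...   | m , a∈ = ⊥-elim (absent m a∈)

count-rebuild : ∀ a P ps → count a (rebuild P ps) ≡ tcount a P + count a ps
count-rebuild a [] ps = refl
count-rebuild a ((q , m) ∷ P) ps with a ≟ₚ q
... | yes refl = begin
  count a (rebuild P (a ∷ ps))      ≡⟨ count-rebuild a P (a ∷ ps) ⟩
  tcount a P + count a (a ∷ ps)     ≡⟨ cong (tcount a P +_) (count-here a ps) ⟩
  tcount a P + suc (count a ps)     ≡⟨ +-suc (tcount a P) (count a ps) ⟩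
  suc (tcount a P) + count a ps     ≡⟨ cong (_+ count a ps) (sym (tcount-here a m P)) ⟩
  tcount a ((a , m) ∷ P) + count a ps ∎
  where open ≡-Reasoning
... | no a≢q = begin
  count a (rebuild P (q ∷ ps))      ≡⟨ count-rebuild a P (q ∷ ps) ⟩
  tcount a P + count a (q ∷ ps)     ≡⟨ cong (tcount a P +_) (count-there a q ps a≢q) ⟩
  tcount a P + count a ps           ≡⟨ cong (_+ count a ps) (sym (tcount-there a q m P a≢q)) ⟩
  tcount a ((q , m) ∷ P) + count a ps ∎
  where open ≡-Reasoning

∈-rebuild⁻ : ∀ a P ps → a ∈ rebuild P ps → (Σ ℕ λ m → (a , m) ∈ P) ⊎ a ∈ ps
∈-rebuild⁻ a [] ps a∈ = inj₂ a∈
∈-rebuild⁻ a ((q , m) ∷ P) ps a∈ with ∈-rebuild⁻ a P (q ∷ ps) a∈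
... | inj₁ (m' , a∈P)     = inj₁ (m' , there a∈P)
... | inj₂ (here refl)    = inj₁ (m , here refl)
... | inj₂ (there a∈ps)   = inj₂ a∈ps

∈-rebuild⁺ʳ : ∀ {a} P ps → a ∈ ps → a ∈ rebuild P ps
∈-rebuild⁺ʳ []            ps a∈ = a∈
∈-rebuild⁺ʳ ((q , _) ∷ P) ps a∈ = ∈-rebuild⁺ʳ P (q ∷ ps) (there a∈)

∈-rebuild⁺ˡ : ∀ a m P ps → (a , m) ∈ P → a ∈ rebuild P ps
∈-rebuild⁺ˡ a m ((q , _) ∷ P) ps (here refl) = ∈-rebuild⁺ʳ P (a ∷ ps) (here refl)
∈-rebuild⁺ˡ a m ((q , _) ∷ P) ps (there a∈) = ∈-rebuild⁺ˡ a m P (q ∷ ps) a∈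

linked-rebuild : ∀ {R : Part → Part → Set} P ps → Linked R (rebuild P ps) → Linked R ps
linked-rebuild []            ps l = l
linked-rebuild ((q , m) ∷ P) ps l with linked-rebuild P (q ∷ ps) l
... | [-]    = []
... | _ ∷ l' = l'

KeyLe : Part → Part → Set
KeyLe p q = key p ≤ key q

linked-head : ∀ {x a xs} → Linked KeyLe (x ∷ xs) → a ∈ xs → key x ≤ key a
linked-head (r ∷ l) (here refl) = r
linked-head (r ∷ l) (there a∈)  = ≤-trans r (linked-head l a∈)

marksWhere-∈⁻ : ∀ Q P v → v ∈ marksWhere Q P → Σ Part λ q → (q , v) ∈ P × Q (size q) ≡ true
marksWhere-∈⁻ Q ((q , m) ∷ P) v v∈ with Q (size q) in eq
marksWhere-∈⁻ Q ((q , m) ∷ P) v (here refl) | true = q , here refl , eq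
marksWhere-∈⁻ Q ((q , m) ∷ P) v (there v∈) | true with marksWhere-∈⁻ Q P v v∈
... | q' , q'∈ , e = q' , there q'∈ , e
marksWhere-∈⁻ Q ((q , m) ∷ P) v v∈ | false with marksWhere-∈⁻ Q P v v∈
... | q' , q'∈ , e = q' , there q'∈ , e

marksWhere-∈⁺ : ∀ Q P q v → (q , v) ∈ P → Q (size q) ≡ true → v ∈ marksWhere Q P
marksWhere-∈⁺ Q ((q' , m) ∷ P) q v (here refl) e rewrite e = here refl
marksWhere-∈⁺ Q ((q' , m) ∷ P) q v (there q∈) e with Q (size q')
... | true  = there (marksWhere-∈⁺ Q P q v q∈ e)
... | false = marksWhere-∈⁺ Q P q v q∈ e

-- g of rule (d): the least mark of a part of size s - 2.
exceptionMark : ℕ → Trace → ℕ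
exceptionMark s P = leastUsed (marksWhere (λ sj → s ≡ᵇ sj + 2) P)

-- The marks among which f of rule (d) is the least unused one.
rangeMarks : ℕ → Trace → List ℕ
rangeMarks s P = marksWhere (λ sj → s ≤ᵇ sj + 2) P

exceptional : List Part → Trace → ℕ → Bool
exceptional μ P s = (2 ≤ᵇ exceptionMark s P) ∧ ((headMark P ≡ᵇ exceptionMark s P ∸ 1)
   ∧ ((occurs (s ∸ 1 , false) μ ∨ occurs (s , true) μ) ∧ not (occurs (s ∸ 1 , true) μ)))

mark-evenPlain : ∀ μ P s → isEven s ≡ true →
  markOf μ P (s , false) ≡ (if exceptional μ P s then exceptionMark s P else leastUnused (rangeMarks s P))
mark-evenPlain μ []      s e = refl
mark-evenPlain μ (_ ∷ P) s e rewrite e = refl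

mark-oddBar : ∀ μ P s → isEven s ≡ false →
  markOf μ P (s , true) ≡ leastUnused (marksWhere (λ sj → s ≡ᵇ sj + 1) P)
mark-oddBar μ []      s e = refl
mark-oddBar μ (_ ∷ P) s e rewrite e = refl

mark-oddPlain : ∀ μ P s → isEven s ≡ false → markOf μ P (s , false) ≡ 1
mark-oddPlain μ []      s e = refl
mark-oddPlain μ (_ ∷ P) s e rewrite e = refl

mark-evenBar : ∀ μ P s → isEven s ≡ true → markOf μ P (s , true) ≡ 1
mark-evenBar μ []      s e = refl
mark-evenBar μ (_ ∷ P) s e rewrite e = refl

mark-pos : ∀ μ P p → 1 ≤ markOf μ P p
mark-pos μ P (s , false) with isEven s in e
... | false rewrite mark-oddPlain μ P s e = ≤-refl
... | true rewrite mark-evenPlain μ P s e with exceptional μ P s in c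
...   | false = leastUnused-pos (rangeMarks s P)
...   | true  = ≤-trans (s≤s z≤n) (≤ᵇ⇒≤ 2 _ (≡true⇒T (∧-conicalˡ _ _ c)))
mark-pos μ P (s , true) with isEven s in e
... | true  rewrite mark-evenBar μ P s e = ≤-refl
... | false rewrite mark-oddBar μ P s e = leastUnused-pos (marksWhere (λ sj → s ≡ᵇ sj + 1) P)

Kind : Part → ℕ → Set
Kind q m = 1 ≤ m × (isEven (size q) ≡ false → overlined q ≡ false → m ≡ 1)
                 × (isEven (size q) ≡ true  → overlined q ≡ true  → m ≡ 1)

kind-new : ∀ μ P p → Kind p (markOf μ P p)
kind-new μ P (s , b) = mark-pos μ P (s , b) , oddPlain b , evenBar b
  where
  oddPlain : ∀ b → isEven s ≡ false → b ≡ false → markOf μ P (s , b) ≡ 1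
  oddPlain false e _ = mark-oddPlain μ P s e
  evenBar : ∀ b → isEven s ≡ true → b ≡ true → markOf μ P (s , b) ≡ 1
  evenBar true e _ = mark-evenBar μ P s e

module Marking (μ : List Part) (ov : IsOverpartition μ) where

  sorted : Linked KeyLe μ
  sorted = proj₁ (proj₂ ov)

  -- A stage of the marking: the parts of 'prev' have been marked, most recent
  -- first, p is about to be marked, and ps are still to come.
  record Stage (prev : Trace) (p : Part) (ps : List Part) : Set where
    field
      rebuilds   : rebuild prev (p ∷ ps) ≡ μ
      before     : ∀ q m → (q , m) ∈ prev → key q ≤ key p
      below-head : ∀ q m → (q , m) ∈ prev → key q ≤ headKey prev
      kinds      : ∀ q m → (q , m) ∈ prev → Kind q m
  open Stage public

  module _ {prev p ps} (c : Stage prev p ps) where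
    traced-∈μ : ∀ q m → (q , m) ∈ prev → q ∈ μ
    traced-∈μ q m q∈ = subst (q ∈_) (rebuilds c) (∈-rebuild⁺ˡ q m prev (p ∷ ps) q∈)

    current-∈μ : p ∈ μ
    current-∈μ = subst (p ∈_) (rebuilds c) (∈-rebuild⁺ʳ prev (p ∷ ps) (here refl))

    traced-pos : ∀ q m → (q , m) ∈ prev → 1 ≤ size q
    traced-pos q m q∈ = All.lookup (proj₁ ov) (traced-∈μ q m q∈)

    current-pos : 1 ≤ size p
    current-pos = All.lookup (proj₁ ov) current-∈μ

    current-occurs : occurs p μ ≡ true
    current-occurs = ∈⇒occurs p μ current-∈μ

    traced-occurs : ∀ a m → (a , m) ∈ prev → occurs a μ ≡ true
    traced-occurs a m a∈ = ∈⇒occurs a μ (traced-∈μ a m a∈)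

    -- Since μ is sorted, a part of μ coming before p has been traced.
    occurs-before⇒traced : ∀ a → occurs a μ ≡ true → key a < key p → Σ ℕ λ m → (a , m) ∈ prev
    occurs-before⇒traced a e a<p
      with ∈-rebuild⁻ a prev (p ∷ ps) (subst (a ∈_) (sym (rebuilds c)) (occurs⇒∈ a μ e))
    ... | inj₁ traced      = traced
    ... | inj₂ (here refl) = ⊥-elim (<-irrefl refl a<p)
    ... | inj₂ (there a∈)  = ⊥-elim (<-irrefl refl (<-≤-trans a<p
            (linked-head (linked-rebuild prev (p ∷ ps) (subst (Linked KeyLe) (sym (rebuilds c)) sorted)) a∈)))

    -- An overlined part occurs only once in μ, so it has not been traced before.
    overlined-untraced : ∀ t → p ≡ (t , true) → ∀ m → (p , m) ∉ prev
    overlined-untraced t e m p∈ = <-irrefl refl (begin-strict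
      1                                ≤⟨ ∈⇒tcount-pos p m prev p∈ ⟩
      tcount p prev                    <⟨ m<m+n (tcount p prev) (∈⇒count-pos p (p ∷ ps) (here refl)) ⟩
      tcount p prev + count p (p ∷ ps) ≡⟨ sym (count-rebuild p prev (p ∷ ps)) ⟩
      count p (rebuild prev (p ∷ ps))  ≡⟨ cong (count p) (rebuilds c) ⟩
      count p μ                        ≤⟨ subst (λ z → count z μ ≤ 1) (sym e) (proj₂ (proj₂ ov) t) ⟩
      1                                ∎)
      where open ≤-Reasoning

    next-key-≥ : ∀ {p' ps'} → ps ≡ p' ∷ ps' → key p ≤ key p'
    next-key-≥ refl =
      linked-head (linked-rebuild prev (p ∷ ps) (subst (Linked KeyLe) (sym (rebuilds c)) sorted)) (here refl)

    traced-size-≤ : ∀ q m → (q , m) ∈ prev → size q ≤ size p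
    traced-size-≤ q m q∈ = key-≤⇒size-≤ q p (before c q m q∈)

    tcount-≤-count : ∀ a m → tcount a ((p , m) ∷ prev) ≤ count a μ
    tcount-≤-count a m = subst (tcount a ((p , m) ∷ prev) ≤_)
      (trans (sym (count-rebuild a ((p , m) ∷ prev) ps)) (cong (count a) (rebuilds c))) (m≤m+n _ _)

  headKey-≤ : ∀ {prev p ps} → Stage prev p ps → headKey prev ≤ key p
  headKey-≤ {[]}          c = z≤n
  headKey-≤ {(q , m) ∷ _} c = before c q m (here refl)

  -- The window of u.  Condition (2) for t = u counts the parts ū, U, X, Z;
  -- condition (3) relates C and Z.  (Z of window u is U of window u + 1.)
  Pū PU PX PC PY PZ : ℕ → Part
  Pū u = (2 * u , true)
  PU u = (2 * u , false)
  PX u = (2 * u + 1 , true)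
  PC u = (2 * u + 1 , false)
  PY u = (2 * u + 2 , true)
  PZ u = (2 * u + 2 , false)

  InWindow : ℕ → Part → Set
  InWindow u q = 2 * u ≤ size q × size q ≤ 2 * u + 2

  data WindowMark (u : ℕ) (P : Trace) (v : ℕ) : Set where
    windowMark : (q : Part) → (q , v) ∈ P → InWindow u q → WindowMark u P v

  windowCount : ℕ → Trace → ℕ
  windowCount u P = tcount (Pū u) P + tcount (PU u) P + tcount (PX u) P + tcount (PZ u) P

  evenMarks : ℕ → Trace → List ℕ
  evenMarks u P = marksWhere (λ sj → (2 * u + 2) ≡ᵇ sj + 2) P

  gMark : ℕ → Trace → ℕ
  gMark u P = exceptionMark (2 * u + 2) P

  Flags : ℕ → Set
  Flags u = ((occurs (2 * u + 2 ∸ 1 , false) μ ∨ occurs (2 * u + 2 , true) μ) ≡ true)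
          × (occurs (2 * u + 2 ∸ 1 , true) μ ≡ false)

  -- A part 2u+1 or ‾2u+2 (both marked 1) has been traced.
  CorY : ℕ → Trace → Set
  CorY u P = 1 ≤ tcount (PC u) P ⊎ 1 ≤ tcount (PY u) P

  -- The three possible relations between the list D of distinct counted marks
  -- and the set of all window marks.
  -- Covering: every window mark is in D, and the exceptional rule for 2u+2
  -- cannot apply after a part C, Y or Z since g ≤ headMark.
  Covering : ℕ → Trace → List ℕ → Set
  Covering u P D = (∀ v → WindowMark u P v → v ∈ D)
    × (2 * (2 * u + 1) ≤ headKey P → headKey P ≤ 2 * (2 * u + 2) → Flags u → 2 ≤ gMark u P → gMark u P ≤ headMark P)

  -- OneApart: the mark 1 of a C or Y is the only window mark outside D; the
  -- exceptional rule is armed (g ≥ 2 lies in D, flags hold, earlier Z marks are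
  -- below g), and g - 1, if used in the window, is the head mark.
  OneApart : ℕ → Trace → List ℕ → Set
  OneApart u P D = (∀ v → WindowMark u P v → v ∈ D ⊎ v ≡ 1) × (1 ∉ D) × (2 ≤ gMark u P) × (gMark u P ∈ D)
    × Flags u × CorY u P
    × (headKey P ≤ 2 * (2 * u + 2) → ∀ v → WindowMark u P v → v ≡ gMark u P ∸ 1 → headMark P ≡ gMark u P ∸ 1)
    × (∀ m → (PZ u , m) ∈ P → m < gMark u P)

  -- OneApartNoEven: as OneApart, but no part of size 2u and no X was traced,
  -- so the exceptional rule is not available.
  OneApartNoEven : ℕ → Trace → List ℕ → Set
  OneApartNoEven u P D = (∀ v → WindowMark u P v → v ∈ D ⊎ v ≡ 1) × (1 ∉ D)
    × (evenMarks u P ≡ []) × (tcount (PX u) P ≡ 0) × CorY u P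

  Witness : ℕ → Trace → Set
  Witness u P = Σ (List ℕ) λ D₂ → Unique D₂ × (∀ d → d ∈ D₂ → WindowMark u P d)
    × (length D₂ ≡ tcount (PZ u) P + 1) × (∀ d → d ∈ D₂ → d ≡ 1 ⊎ (PZ u , d) ∈ P)

  -- Once a C is traced, there is a witness (this gives condition (3)).
  OddWitness : ℕ → Trace → Set
  OddWitness u P = 1 ≤ tcount (PC u) P → Witness u P

  record Inv (u : ℕ) (P : Trace) : Set where
    constructor mkInv
    field
      D        : List ℕ
      D-unique : Unique D
      D-window : ∀ d → d ∈ D → WindowMark u P d
      D-length : length D ≡ windowCount u P
      mode     : Covering u P D ⊎ OneApart u P D ⊎ OneApartNoEven u P D
      Z-covers : headKey P ≡ 2 * (2 * u + 2) → ∀ v → 1 ≤ v → v ≤ headMark P → WindowMark u P v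
      X-mark1  : 1 ≤ tcount (PX u) P → WindowMark u P 1
      C-witness : OddWitness u P

  data Position (u : ℕ) : Part → Set where
    below : ∀ {q} → size q < 2 * u → Position u q
    isū   : Position u (Pū u)
    isU   : Position u (PU u)
    isX   : Position u (PX u)
    isC   : Position u (PC u)
    isY   : Position u (PY u)
    isZ   : Position u (PZ u)
    above : ∀ {q} → 2 * u + 2 < size q → Position u q

  position : ∀ u q → Position u q
  position u (s , b) with <-cmp s (2 * u)
  ... | tri< s< _ _ = below s<
  ... | tri≈ _ refl _ = even b
    where
    even : ∀ b → Position u (2 * u , b)
    even true  = isū
    even false = isU
  ... | tri> _ _ s> with <-cmp s (2 * u + 1)
  ... | tri< s< _ _ = ⊥-elim (<-irrefl refl (≤-trans s< (≤-trans (≤-reflexive (2u+1≡suc u)) s>)))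
  ... | tri≈ _ refl _ = odd b
    where
    odd : ∀ b → Position u (2 * u + 1 , b)
    odd true  = isX
    odd false = isC
  ... | tri> _ _ s>' with <-cmp s (2 * u + 2)
  ... | tri< s< _ _ = ⊥-elim (<-irrefl refl (≤-trans s< (≤-trans (≤-reflexive (2u+2≡suc u)) s>')))
  ... | tri≈ _ refl _ = next b
    where
    next : ∀ b → Position u (2 * u + 2 , b)
    next true  = isY
    next false = isZ
  ... | tri> _ _ s>'' = above s>''

  windowMark-there : ∀ {u P p m v} → WindowMark u P v → WindowMark u ((p , m) ∷ P) v
  windowMark-there (windowMark q q∈ w) = windowMark q (there q∈) w

  windowMark-here : ∀ {u P p m} → InWindow u p → WindowMark u ((p , m) ∷ P) m
  windowMark-here {p = p} w = windowMark p (here refl) w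

  windowMark-split : ∀ {u P p m v} → WindowMark u ((p , m) ∷ P) v → (InWindow u p × v ≡ m) ⊎ WindowMark u P v
  windowMark-split (windowMark q (here refl) w) = inj₁ (w , refl)
  windowMark-split (windowMark q (there q∈) w) = inj₂ (windowMark q q∈ w)

  windowCount-other : ∀ u P p m → p ≢ Pū u → p ≢ PU u → p ≢ PX u → p ≢ PZ u →
                      windowCount u ((p , m) ∷ P) ≡ windowCount u P
  windowCount-other u P p m ≢ū ≢U ≢X ≢Z
    rewrite tcount-there (Pū u) p m P (≢ū ∘ sym) | tcount-there (PU u) p m P (≢U ∘ sym)
          | tcount-there (PX u) p m P (≢X ∘ sym) | tcount-there (PZ u) p m P (≢Z ∘ sym) = refl

  windowCount-ū : ∀ u P m → windowCount u ((Pū u , m) ∷ P) ≡ suc (windowCount u P)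
  windowCount-ū u P m
    rewrite tcount-here (Pū u) m P | tcount-there (PU u) (Pū u) m P (overlined-≢ false≢true)
          | tcount-there (PX u) (Pū u) m P (size-≢ (≢01 u ∘ sym))
          | tcount-there (PZ u) (Pū u) m P (size-≢ (≢02 u ∘ sym)) = refl

  windowCount-U : ∀ u P m → windowCount u ((PU u , m) ∷ P) ≡ suc (windowCount u P)
  windowCount-U u P m
    rewrite tcount-there (Pū u) (PU u) m P (overlined-≢ true≢false) | tcount-here (PU u) m P
          | tcount-there (PX u) (PU u) m P (size-≢ (≢01 u ∘ sym))
          | tcount-there (PZ u) (PU u) m P (size-≢ (≢02 u ∘ sym))
    = cong (λ z → z + tcount (PX u) P + tcount (PZ u) P) (+-suc (tcount (Pū u) P) _)

  windowCount-X : ∀ u P m → windowCount u ((PX u , m) ∷ P) ≡ suc (windowCount u P)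
  windowCount-X u P m
    rewrite tcount-there (Pū u) (PX u) m P (size-≢ (≢01 u)) | tcount-there (PU u) (PX u) m P (size-≢ (≢01 u))
          | tcount-here (PX u) m P | tcount-there (PZ u) (PX u) m P (overlined-≢ false≢true)
    = cong (_+ tcount (PZ u) P) (+-suc (tcount (Pū u) P + tcount (PU u) P) _)

  windowCount-Z : ∀ u P m → windowCount u ((PZ u , m) ∷ P) ≡ suc (windowCount u P)
  windowCount-Z u P m
    rewrite tcount-there (Pū u) (PZ u) m P (size-≢ (≢02 u)) | tcount-there (PU u) (PZ u) m P (size-≢ (≢02 u))
          | tcount-there (PX u) (PZ u) m P (overlined-≢ true≢false) | tcount-here (PZ u) m P
    = +-suc (tcount (Pū u) P + tcount (PU u) P + tcount (PX u) P) _

  shiftTest⇒ : ∀ c n s → ((n + c) ≡ᵇ s + c) ≡ true → s ≡ n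
  shiftTest⇒ c n s e = sym (+-cancelʳ-≡ c n s (≡ᵇ≡true⇒≡ e))

  shiftTest⇐ : ∀ c n s → s ≡ n → ((n + c) ≡ᵇ s + c) ≡ true
  shiftTest⇐ c n s e = ≡⇒≡ᵇ≡true (cong (_+ c) (sym e))

  shiftTest-false : ∀ c n s → s ≢ n → ((n + c) ≡ᵇ s + c) ≡ false
  shiftTest-false c n s s≢n = ≢⇒≡ᵇ≡false (λ e → s≢n (sym (+-cancelʳ-≡ c n s e)))

  rangeTest⇒ : ∀ c n s → ((n + c) ≤ᵇ s + c) ≡ true → n ≤ s
  rangeTest⇒ c n s e = +-cancelʳ-≤ c n s (≤ᵇ≡true⇒≤ e)

  rangeTest⇐ : ∀ c n s → n ≤ s → ((n + c) ≤ᵇ s + c) ≡ true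
  rangeTest⇐ c n s n≤s = ≤⇒≤ᵇ≡true (+-monoˡ-≤ c n≤s)

  -- Marks of traced parts of size 2u: those avoided by rule (c) for X = ‾2u+1,
  -- and those among which g of rule (d) for Z = 2u+2 is the least.
  oddBarMarks : ℕ → Trace → List ℕ
  oddBarMarks u P = marksWhere (λ sj → (2 * u + 1) ≡ᵇ sj + 1) P

  oddBarMarks-∈⁻ : ∀ u P v → v ∈ oddBarMarks u P → Σ Part λ q → (q , v) ∈ P × size q ≡ 2 * u
  oddBarMarks-∈⁻ u P v v∈ with marksWhere-∈⁻ _ P v v∈
  ... | q , q∈ , e = q , q∈ , shiftTest⇒ 1 (2 * u) (size q) e

  oddBarMarks-∈⁺ : ∀ u P q v → (q , v) ∈ P → size q ≡ 2 * u → v ∈ oddBarMarks u P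
  oddBarMarks-∈⁺ u P q v q∈ e = marksWhere-∈⁺ _ P q v q∈ (shiftTest⇐ 1 (2 * u) (size q) e)

  evenMarks-∈⁻ : ∀ u P v → v ∈ evenMarks u P → Σ Part λ q → (q , v) ∈ P × size q ≡ 2 * u
  evenMarks-∈⁻ u P v v∈ with marksWhere-∈⁻ _ P v v∈
  ... | q , q∈ , e = q , q∈ , shiftTest⇒ 2 (2 * u) (size q) e

  evenMarks-∈⁺ : ∀ u P q v → (q , v) ∈ P → size q ≡ 2 * u → v ∈ evenMarks u P
  evenMarks-∈⁺ u P q v q∈ e = marksWhere-∈⁺ _ P q v q∈ (shiftTest⇐ 2 (2 * u) (size q) e)

  evenMarks-window : ∀ u P v → v ∈ evenMarks u P → WindowMark u P v
  evenMarks-window u P v v∈ with evenMarks-∈⁻ u P v v∈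
  ... | q , q∈ , e = windowMark q q∈ (≤-reflexive (sym e) , ≤-trans (≤-reflexive e) (<⇒≤ (<02 u)))

  evenMarks-other : ∀ u P p m → size p ≢ 2 * u → evenMarks u ((p , m) ∷ P) ≡ evenMarks u P
  evenMarks-other u P p m ≢2u rewrite shiftTest-false 2 (2 * u) (size p) ≢2u = refl

  gMark-other : ∀ u P p m → size p ≢ 2 * u → gMark u ((p , m) ∷ P) ≡ gMark u P
  gMark-other u P p m ≢2u = cong leastUsed (evenMarks-other u P p m ≢2u)

  rangeMarks-window : ∀ u P v → v ∈ rangeMarks (2 * u + 2) P →
                      (∀ q m → (q , m) ∈ P → size q ≤ 2 * u + 2) → WindowMark u P v
  rangeMarks-window u P v v∈ small with marksWhere-∈⁻ _ P v v∈
  ... | q , q∈ , e = windowMark q q∈ (rangeTest⇒ 2 (2 * u) (size q) e , small q v q∈)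

  window-rangeMarks : ∀ u P v → WindowMark u P v → v ∈ rangeMarks (2 * u + 2) P
  window-rangeMarks u P v (windowMark q q∈ (2u≤ , _)) = marksWhere-∈⁺ _ P q v q∈ (rangeTest⇐ 2 (2 * u) (size q) 2u≤)

  exceptional⇒ : ∀ u P → exceptional μ P (2 * u + 2) ≡ true →
                 2 ≤ gMark u P × headMark P ≡ gMark u P ∸ 1 × Flags u
  exceptional⇒ u P e =
    ≤ᵇ≡true⇒≤ (∧-conicalˡ _ _ e) , ≡ᵇ≡true⇒≡ (∧-conicalˡ _ _ rest) ,
    ∧-conicalˡ _ _ flags , not≡true⇒ _ (∧-conicalʳ _ _ flags)
    where
    g = exceptionMark (2 * u + 2) P
    occursTest = occurs (2 * u + 2 ∸ 1 , false) μ ∨ occurs (2 * u + 2 , true) μ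
    noXTest = not (occurs (2 * u + 2 ∸ 1 , true) μ)
    rest : ((headMark P ≡ᵇ g ∸ 1) ∧ (occursTest ∧ noXTest)) ≡ true
    rest = ∧-conicalʳ (2 ≤ᵇ g) _ e
    flags : (occursTest ∧ noXTest) ≡ true
    flags = ∧-conicalʳ (headMark P ≡ᵇ g ∸ 1) _ rest

  exceptional⇐ : ∀ u P → 2 ≤ gMark u P → headMark P ≡ gMark u P ∸ 1 → Flags u →
                 exceptional μ P (2 * u + 2) ≡ true
  exceptional⇐ u P 2≤g head (occ , noX) =
    ∧-true (≤⇒≤ᵇ≡true 2≤g) (∧-true (≡⇒≡ᵇ≡true head) (∧-true occ (not-false noX)))

  C-mark1 : ∀ u m → Kind (PC u) m → m ≡ 1
  C-mark1 u m (_ , oddPlain , _) = oddPlain (isEven-2*+1 u) refl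

  Y-mark1 : ∀ u m → Kind (PY u) m → m ≡ 1
  Y-mark1 u m (_ , _ , evenBar) = evenBar (isEven-2*+2 u) refl
  X-mark1-other : ∀ u P p m → p ≢ PX u → (1 ≤ tcount (PX u) P → WindowMark u P 1) →
                  1 ≤ tcount (PX u) ((p , m) ∷ P) → WindowMark u ((p , m) ∷ P) 1
  X-mark1-other u P p m ≢X X-mark1 X∈ =
    windowMark-there (X-mark1 (subst (1 ≤_) (tcount-there (PX u) p m P (≢X ∘ sym)) X∈))

  witness-there : ∀ u P p m → p ≢ PZ u → Witness u P → Witness u ((p , m) ∷ P)
  witness-there u P p m ≢Z (D₂ , D₂-unique , D₂-window , D₂-length , D₂-marks) =
    D₂ , D₂-unique , (λ d d∈ → windowMark-there (D₂-window d d∈))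
       , trans D₂-length (cong (_+ 1) (sym (tcount-there (PZ u) p m P (≢Z ∘ sym))))
       , (λ d d∈ → Sum.map₂ there (D₂-marks d d∈))

  C-witness-other : ∀ u P p m → p ≢ PC u → p ≢ PZ u → OddWitness u P → OddWitness u ((p , m) ∷ P)
  C-witness-other u P p m ≢C ≢Z C-witness C∈ =
    witness-there u P p m ≢Z (C-witness (subst (1 ≤_) (tcount-there (PC u) p m P (≢C ∘ sym)) C∈))

  CorY-there : ∀ u P p m → CorY u P → CorY u ((p , m) ∷ P)
  CorY-there u P p m = Sum.map (λ C∈ → ≤-trans C∈ (tcount-mono _ P p m)) (λ Y∈ → ≤-trans Y∈ (tcount-mono _ P p m))

  inv-below : ∀ u P → (∀ q m → (q , m) ∈ P → size q < 2 * u) → Inv u P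
  inv-below u P small = mkInv [] [] (λ _ ()) (sym count0)
      (inj₁ ((λ v v∈ → ⊥-elim (no-window-mark v v∈)) , (λ C≤head _ _ _ → ⊥-elim (<-irrefl refl (<-≤-trans head<C C≤head)))))
      (λ head≡Z → ⊥-elim (<-irrefl head≡Z (<-trans head<C (size-<⇒key-< (PC u) (PZ u) (<12 u)))))
      (λ X∈ → let (m , X∈P) = tcount-pos⇒∈ (PX u) P X∈ in ⊥-elim (not-in-window (PX u) m X∈P (<⇒≤ (<01 u))))
      (λ C∈ → let (m , C∈P) = tcount-pos⇒∈ (PC u) P C∈ in ⊥-elim (not-in-window (PC u) m C∈P (<⇒≤ (<01 u))))
    where
    not-in-window : ∀ q m → (q , m) ∈ P → 2 * u ≤ size q → ⊥
    not-in-window q m q∈ 2u≤ = <-irrefl refl (<-≤-trans (small q m q∈) 2u≤)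
    no-window-mark : ∀ v → WindowMark u P v → ⊥
    no-window-mark v (windowMark q q∈ (2u≤ , _)) = not-in-window q v q∈ 2u≤
    head<C : headKey P < key (PC u)
    head<C = below-C P small
      where
      below-C : ∀ Q → (∀ q m → (q , m) ∈ Q → size q < 2 * u) → headKey Q < key (PC u)
      below-C []          _      = size-<⇒key-< (0 , false) (PC u) (1≤2u+1 u)
      below-C ((q , m) ∷ _) small' = size-<⇒key-< q (PC u) (<-trans (small' q m (here refl)) (<01 u))
    absent : ∀ a → 2 * u ≤ size a → tcount a P ≡ 0
    absent a 2u≤ = tcount-zero a P (λ m a∈ → not-in-window a m a∈ 2u≤)
    count0 : windowCount u P ≡ 0
    count0 rewrite absent (Pū u) ≤-refl | absent (PU u) ≤-refl
                 | absent (PX u) (<⇒≤ (<01 u)) | absent (PZ u) (<⇒≤ (<02 u)) = refl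

  inv-above : ∀ u P p m → 2 * u + 2 < size p → Inv u P → Inv u ((p , m) ∷ P)
  inv-above u P p m beyond (mkInv D D-unique D-window D-length mode Z-covers X-mark1 C-witness) =
    mkInv D D-unique (λ d d∈ → windowMark-there (D-window d d∈)) (trans D-length (sym same-count)) (mode' mode)
      (λ head≡Z → ⊥-elim (head-beyond (≤-reflexive head≡Z)))
      (X-mark1-other u P p m (not-window (<⇒≤ (<12 u))) X-mark1)
      (C-witness-other u P p m (not-window (<⇒≤ (<12 u))) (not-window ≤-refl) C-witness)
    where
    P' = (p , m) ∷ P
    not-window : ∀ {s b} → s ≤ 2 * u + 2 → p ≢ (s , b)
    not-window s≤ e = <-irrefl refl (<-≤-trans beyond (≤-trans (≤-reflexive (cong proj₁ e)) s≤))
    not-2u : size p ≢ 2 * u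
    not-2u e = not-window (<⇒≤ (<02 u)) (cong (_, overlined p) e)
    same-count : windowCount u P' ≡ windowCount u P
    same-count = windowCount-other u P p m (not-window (<⇒≤ (<02 u))) (not-window (<⇒≤ (<02 u)))
                                           (not-window (<⇒≤ (<12 u))) (not-window ≤-refl)
    same-g : gMark u P' ≡ gMark u P
    same-g = gMark-other u P p m not-2u
    head-beyond : ¬ (headKey P' ≤ 2 * (2 * u + 2))
    head-beyond le = <-irrefl refl (<-≤-trans (size-<⇒key-< (PZ u) p beyond) le)
    old-mark : ∀ v → WindowMark u P' v → WindowMark u P v
    old-mark v v∈ with windowMark-split v∈
    ... | inj₁ ((_ , p≤) , _) = ⊥-elim (<-irrefl refl (<-≤-trans beyond p≤))
    ... | inj₂ old = old
    mode' : Covering u P D ⊎ OneApart u P D ⊎ OneApartNoEven u P D →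
            Covering u P' D ⊎ OneApart u P' D ⊎ OneApartNoEven u P' D
    mode' (inj₁ (in-D , _)) = inj₁ ((λ v v∈ → in-D v (old-mark v v∈)) , (λ _ le → ⊥-elim (head-beyond le)))
    mode' (inj₂ (inj₁ (in-D , 1∉D , 2≤g , g∈D , flags , CY , _ , Z<g))) =
      inj₂ (inj₁ ((λ v v∈ → in-D v (old-mark v v∈)) , 1∉D , subst (2 ≤_) (sym same-g) 2≤g , subst (_∈ D) (sym same-g) g∈D
                 , flags , CorY-there u P p m CY , (λ le → ⊥-elim (head-beyond le)) , Z<g'))
      where
      Z<g' : ∀ m' → (PZ u , m') ∈ P' → m' < gMark u P'
      Z<g' m' (here e)   = ⊥-elim (not-window ≤-refl (sym (cong proj₁ e)))
      Z<g' m' (there Z∈) = subst (m' <_) (sym same-g) (Z<g m' Z∈)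
    mode' (inj₂ (inj₂ (in-D , 1∉D , no-even , no-X , CY))) =
      inj₂ (inj₂ ((λ v v∈ → in-D v (old-mark v v∈)) , 1∉D , trans (evenMarks-other u P p m not-2u) no-even
                 , trans (tcount-there (PX u) p m P (not-window (<⇒≤ (<12 u)) ∘ sym)) no-X , CorY-there u P p m CY))

  C<Y : ∀ u → key (PC u) < key (PY u)
  C<Y u = size-<⇒key-< (PC u) (PY u) (<12 u)

  Y<Z : ∀ u → key (PY u) < key (PZ u)
  Y<Z u = overlined-< (2 * u + 2) (1≤2u+2 u)

  X<C : ∀ u → key (PX u) < key (PC u)
  X<C u = overlined-< (2 * u + 1) (1≤2u+1 u)

  U<X : ∀ u → key (PU u) < key (PX u)
  U<X u = size-<⇒key-< (PU u) (PX u) (<01 u)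

  C<Z : ∀ u → key (PC u) < key (PZ u)
  C<Z u = <-trans (C<Y u) (Y<Z u)

  head-C-to-Z : ∀ {prev p ps} → Stage prev p ps → ∀ u → key (PC u) ≤ headKey prev → headKey prev ≤ key (PZ u) →
                headMark prev ≡ 1 ⊎ headKey prev ≡ key (PZ u)
  head-C-to-Z {[]} c u C≤ _ = ⊥-elim (<-irrefl refl (<-≤-trans (size-<⇒key-< (0 , false) (PC u) (1≤2u+1 u)) C≤))
  head-C-to-Z {(h , mh) ∷ rest} c u C≤ ≤Z with position u h
  ... | below h< = ⊥-elim (<-irrefl refl (<-≤-trans (size-<⇒key-< h (PC u) (<-trans h< (<01 u))) C≤))
  ... | isū      = ⊥-elim (<-irrefl refl (<-≤-trans (size-<⇒key-< h (PC u) (<01 u)) C≤))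
  ... | isU      = ⊥-elim (<-irrefl refl (<-≤-trans (size-<⇒key-< h (PC u) (<01 u)) C≤))
  ... | isX      = ⊥-elim (<-irrefl refl (<-≤-trans (X<C u) C≤))
  ... | isC      = inj₁ (C-mark1 u mh (kinds c (PC u) mh (here refl)))
  ... | isY      = inj₁ (Y-mark1 u mh (kinds c (PY u) mh (here refl)))
  ... | isZ      = inj₂ refl
  ... | above h> = ⊥-elim (<-irrefl refl (<-≤-trans (size-<⇒key-< (PZ u) h h>) ≤Z))

  module _ {prev p ps} (c : Stage prev p ps) where
    CorY-headKey : ∀ u → CorY u prev → key (PC u) ≤ headKey prev
    CorY-headKey u (inj₁ C∈) = let (m , C∈P) = tcount-pos⇒∈ (PC u) prev C∈ in below-head c (PC u) m C∈P
    CorY-headKey u (inj₂ Y∈) = let (m , Y∈P) = tcount-pos⇒∈ (PY u) prev Y∈ in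
      ≤-trans (<⇒≤ (C<Y u)) (below-head c (PY u) m Y∈P)

    CorY-mark1 : ∀ u → CorY u prev → WindowMark u prev 1
    CorY-mark1 u (inj₁ C∈) = let (m , C∈P) = tcount-pos⇒∈ (PC u) prev C∈ in
      windowMark (PC u) (subst (λ z → (PC u , z) ∈ prev) (C-mark1 u m (kinds c _ m C∈P)) C∈P) (<⇒≤ (<01 u) , <⇒≤ (<12 u))
    CorY-mark1 u (inj₂ Y∈) = let (m , Y∈P) = tcount-pos⇒∈ (PY u) prev Y∈ in
      windowMark (PY u) (subst (λ z → (PY u , z) ∈ prev) (Y-mark1 u m (kinds c _ m Y∈P)) Y∈P) (<⇒≤ (<02 u) , ≤-refl)

    flags-CorY : ∀ u → Flags u → key (PY u) < key p → CorY u prev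
    flags-CorY u (occ , _) Y<p
      with ∨≡true⇒ _ _ (subst (λ z → (occurs (z , false) μ ∨ occurs (PY u) μ) ≡ true) (2u+2∸1 u) occ)
    ... | inj₁ C∈μ = inj₁ (let (m , C∈) = occurs-before⇒traced c (PC u) C∈μ (<-trans (C<Y u) Y<p) in ∈⇒tcount-pos (PC u) m prev C∈)
    ... | inj₂ Y∈μ = inj₂ (let (m , Y∈) = occurs-before⇒traced c (PY u) Y∈μ Y<p in ∈⇒tcount-pos (PY u) m prev Y∈)

    flags-no-X : ∀ u → Flags u → ∀ m → (PX u , m) ∉ prev
    flags-no-X u (_ , noX) m X∈
      with trans (sym (traced-occurs c (PX u) m X∈)) (subst (λ z → occurs (z , true) μ ≡ false) (2u+2∸1 u) noX)
    ... | ()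

  -- Before C, only the covering mode is possible (the other modes need a traced C or Y).
  covering-before-C : ∀ {prev p ps} → Stage prev p ps → ∀ u D → key p < key (PC u) →
                      Covering u prev D ⊎ OneApart u prev D ⊎ OneApartNoEven u prev D → Covering u prev D
  covering-before-C c u D p<C (inj₁ cover) = cover
  covering-before-C c u D p<C (inj₂ (inj₁ (_ , _ , _ , _ , _ , CY , _))) =
    ⊥-elim (<-irrefl refl (<-≤-trans p<C (≤-trans (CorY-headKey c u CY) (headKey-≤ c))))
  covering-before-C c u D p<C (inj₂ (inj₂ (_ , _ , _ , _ , CY))) =
    ⊥-elim (<-irrefl refl (<-≤-trans p<C (≤-trans (CorY-headKey c u CY) (headKey-≤ c))))

  inv-extend : ∀ {prev p ps u} → Stage prev p ps → Inv u prev → ∀ m →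
               key p < key (PC u) → InWindow u p → ¬ WindowMark u prev m →
               windowCount u ((p , m) ∷ prev) ≡ suc (windowCount u prev) →
               (1 ≤ tcount (PX u) ((p , m) ∷ prev) → WindowMark u ((p , m) ∷ prev) 1) →
               Inv u ((p , m) ∷ prev)
  inv-extend {prev} {p} {ps} {u} c I m p<C p∈W new count-suc X-mark1' =
    mkInv (m ∷ D) ((new ∘ D-window m) ∷ᵘ D-unique) D'-window (trans (cong suc D-length) (sym count-suc))
      (inj₁ (all-in-D' , λ C≤p _ _ _ → ⊥-elim (<-irrefl refl (<-≤-trans p<C C≤p))))
      (λ p≡Z → ⊥-elim (<-irrefl p≡Z p<Z))
      X-mark1'
      (C-witness-other u prev p m (λ e → <-irrefl (cong key e) p<C) (λ e → <-irrefl (cong key e) p<Z) C-witness)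
    where
    open Inv I
    P' = (p , m) ∷ prev
    p<Z : key p < key (PZ u)
    p<Z = <-trans p<C (C<Z u)
    D'-window : ∀ d → d ∈ m ∷ D → WindowMark u P' d
    D'-window d (here refl) = windowMark-here p∈W
    D'-window d (there d∈)  = windowMark-there (D-window d d∈)
    all-in-D' : ∀ v → WindowMark u P' v → v ∈ m ∷ D
    all-in-D' v v∈ with windowMark-split v∈
    ... | inj₁ (_ , refl) = here refl
    ... | inj₂ old        = there (proj₁ (covering-before-C c u D p<C mode) v old)

  -- Rule (b): ū is marked 1, and no window part was traced before it.
  inv-ū : ∀ {prev ps u} → Stage prev (Pū u) ps → Inv u ((Pū u , markOf μ prev (Pū u)) ∷ prev)
  inv-ū {prev} {ps} {u} c rewrite mark-evenBar μ prev (2 * u) (isEven-2* u) =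
    inv-extend c I₀ 1 (size-<⇒key-< (Pū u) (PC u) (<01 u)) (≤-refl , <⇒≤ (<02 u))
      (λ { (windowMark q q∈ (2u≤ , _)) → <-irrefl refl (<-≤-trans (small q 1 q∈) 2u≤) })
      (windowCount-ū u prev 1)
      (X-mark1-other u prev (Pū u) 1 (size-≢ (≢01 u)) (Inv.X-mark1 I₀))
    where
    -- the parts before ū are smaller than 2u, since ū occurs only once
    small : ∀ q m → (q , m) ∈ prev → size q < 2 * u
    small (s , b) m q∈ with m≤n⇒m<n∨m≡n (traced-size-≤ c (s , b) m q∈)
    ... | inj₁ s< = s<
    ... | inj₂ refl with ≤-overlined⇒overlined s b (traced-pos c (s , b) m q∈) (before c (s , b) m q∈)
    ...   | refl = ⊥-elim (overlined-untraced c (2 * u) refl m q∈)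
    I₀ : Inv u prev
    I₀ = inv-below u prev small

  -- U = 2u is the part Z of the window of u - 1; its mark m is not the mark of an
  -- earlier part of size 2u (this is established by 'inv-Z' for u - 1).
  inv-U : ∀ {prev ps u} → Stage prev (PU u) ps → ∀ m → (∀ q → (q , m) ∈ prev → size q ≢ 2 * u) →
          Inv u prev → Inv u ((PU u , m) ∷ prev)
  inv-U {prev} {ps} {u} c m new I =
    inv-extend c I m (<-trans (U<X u) (X<C u)) (≤-refl , <⇒≤ (<02 u)) not-yet (windowCount-U u prev m)
      (X-mark1-other u prev (PU u) m (size-≢ (≢01 u)) (Inv.X-mark1 I))
    where
    not-yet : ¬ WindowMark u prev m
    not-yet (windowMark q q∈ (2u≤ , _)) = new q q∈ (≤-antisym (traced-size-≤ c q m q∈) 2u≤)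

  -- Rule (c): X = ‾2u+1 gets the least mark m not used by a part of size 2u.
  -- Before X the window holds only parts of size 2u, so m is a new window mark,
  -- and all of [1, m) are in D, whence m ≤ windowCount.
  inv-X : ∀ {prev ps u} → Stage prev (PX u) ps → Inv u prev →
          let m = markOf μ prev (PX u) in Inv u ((PX u , m) ∷ prev) × m ≤ windowCount u ((PX u , m) ∷ prev)
  inv-X {prev} {ps} {u} c I rewrite mark-oddBar μ prev (2 * u + 1) (isEven-2*+1 u) =
    inv-extend c I m (X<C u) X∈W not-yet (windowCount-X u prev m) mark1
    , (begin
        m                             ≤⟨ covering-below m D (leastUnused-pos L) (λ v 1≤v v<m → all-in-D v (below-m v 1≤v v<m)) ⟩
        suc (length D)                ≡⟨ cong suc D-length ⟩
        suc (windowCount u prev)      ≡⟨ sym (windowCount-X u prev m) ⟩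
        windowCount u ((PX u , m) ∷ prev) ∎)
    where
    open Inv I
    open ≤-Reasoning
    L = oddBarMarks u prev
    m = leastUnused L
    X∈W : InWindow u (PX u)
    X∈W = <⇒≤ (<01 u) , <⇒≤ (<12 u)
    all-in-D : ∀ v → WindowMark u prev v → v ∈ D
    all-in-D = proj₁ (covering-before-C c u D (X<C u) mode)
    size-2u : ∀ q v → (q , v) ∈ prev → InWindow u q → size q ≡ 2 * u
    size-2u (s , b) v q∈ (2u≤ , _) with m≤n⇒m<n∨m≡n (traced-size-≤ c (s , b) v q∈)
    ... | inj₁ s< = ≤-antisym (≤-pred (≤-trans s< (≤-reflexive (2u+1≡suc u)))) 2u≤
    ... | inj₂ refl with b
    ...   | true  = ⊥-elim (overlined-untraced c (2 * u + 1) refl v q∈)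
    ...   | false = ⊥-elim (<-irrefl refl (<-≤-trans (X<C u) (before c _ v q∈)))
    below-m : ∀ v → 1 ≤ v → v < m → WindowMark u prev v
    below-m v 1≤v v<m with oddBarMarks-∈⁻ u prev v (leastUnused-below L v 1≤v v<m)
    ... | q , q∈ , e = windowMark q q∈ (≤-reflexive (sym e) , ≤-trans (≤-reflexive e) (<⇒≤ (<02 u)))
    not-yet : ¬ WindowMark u prev m
    not-yet (windowMark q q∈ w) = leastUnused-∉ L (oddBarMarks-∈⁺ u prev q m q∈ (size-2u q m q∈ w))
    mark1 : 1 ≤ tcount (PX u) ((PX u , m) ∷ prev) → WindowMark u ((PX u , m) ∷ prev) 1
    mark1 _ with m≤n⇒m<n∨m≡n (leastUnused-pos L)
    ... | inj₂ 1≡m = subst (WindowMark u ((PX u , m) ∷ prev)) (sym 1≡m) (windowMark-here X∈W)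
    ... | inj₁ 1<m = windowMark-there (below-m 1 ≤-refl 1<m)
  -- The parts C = 2u+1 and Y = ‾2u+2: both are marked 1 and neither is counted.
  data IsCY (u : ℕ) : Part → Set where
    C-part : IsCY u (PC u)
    Y-part : IsCY u (PY u)

  module _ {u : ℕ} where
    CY-after-C : ∀ {p} → IsCY u p → key (PC u) ≤ key p
    CY-after-C C-part = ≤-refl
    CY-after-C Y-part = <⇒≤ (C<Y u)

    CY-before-Z : ∀ {p} → IsCY u p → key p < key (PZ u)
    CY-before-Z C-part = C<Z u
    CY-before-Z Y-part = Y<Z u

    CY-size : ∀ {p} → IsCY u p → size p ≢ 2 * u
    CY-size C-part = ≢01 u ∘ sym
    CY-size Y-part = ≢02 u ∘ sym

    CY≢ū : ∀ {p} → IsCY u p → p ≢ Pū u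
    CY≢ū cy = size-≢ (CY-size cy)

    CY≢U : ∀ {p} → IsCY u p → p ≢ PU u
    CY≢U cy = size-≢ (CY-size cy)

    CY≢X : ∀ {p} → IsCY u p → p ≢ PX u
    CY≢X C-part = overlined-≢ false≢true
    CY≢X Y-part = size-≢ (≢12 u ∘ sym)

    CY≢Z : ∀ {p} → IsCY u p → p ≢ PZ u
    CY≢Z C-part = size-≢ (≢12 u)
    CY≢Z Y-part = overlined-≢ true≢false

    CY-CorY : ∀ {p} P m → IsCY u p → CorY u ((p , m) ∷ P)
    CY-CorY P m C-part = inj₁ (subst (1 ≤_) (sym (tcount-here (PC u) m P)) (s≤s z≤n))
    CY-CorY P m Y-part = inj₂ (subst (1 ≤_) (sym (tcount-here (PY u) m P)) (s≤s z≤n))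

    CY-occurs : ∀ {p} → IsCY u p → occurs p μ ≡ true →
                (occurs (2 * u + 2 ∸ 1 , false) μ ∨ occurs (2 * u + 2 , true) μ) ≡ true
    CY-occurs C-part e rewrite 2u+2∸1 u = ∨-trueˡ _ e
    CY-occurs Y-part e rewrite 2u+2∸1 u = ∨-trueʳ _ e

  -- Tracing a C or Y, marked 1.  D is unchanged; when 1 ∉ D the mode becomes
  -- OneApart (or OneApartNoEven if no part of size 2u was traced).
  module CorYStep {prev ps u p} (c : Stage prev p ps) (cy : IsCY u p) where
    P' : Trace
    P' = (p , 1) ∷ prev

    same-g : gMark u P' ≡ gMark u prev
    same-g = gMark-other u prev p 1 (CY-size cy)

    head≤Z : headKey prev ≤ key (PZ u)
    head≤Z = <⇒≤ (≤-<-trans (headKey-≤ c) (CY-before-Z cy))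

    -- A traced window part has size 2u, or is X, C or Y (Z comes after p).
    data WindowPart (q : Part) : Set where
      even-part : size q ≡ 2 * u → WindowPart q
      X-part    : q ≡ PX u → WindowPart q
      CY-part   : IsCY u q → WindowPart q

    windowPart : ∀ q v → (q , v) ∈ prev → InWindow u q → WindowPart q
    windowPart q v q∈ (2u≤ , ≤2u+2) with position u q
    ... | below q< = ⊥-elim (<-irrefl refl (<-≤-trans q< 2u≤))
    ... | isū      = even-part refl
    ... | isU      = even-part refl
    ... | isX      = X-part refl
    ... | isC      = CY-part C-part
    ... | isY      = CY-part Y-part
    ... | isZ      = ⊥-elim (<-irrefl refl (<-≤-trans (CY-before-Z cy) (before c _ v q∈)))
    ... | above q> = ⊥-elim (<-irrefl refl (<-≤-trans q> ≤2u+2))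

    traced-CorY : ∀ {q} v → IsCY u q → (q , v) ∈ prev → CorY u prev
    traced-CorY v C-part q∈ = inj₁ (∈⇒tcount-pos _ v prev q∈)
    traced-CorY v Y-part q∈ = inj₂ (∈⇒tcount-pos _ v prev q∈)

    -- Between a traced C/Y and p there is no Z, so the head is a C or Y.
    head-mark1 : CorY u prev → headMark prev ≡ 1
    head-mark1 CY with head-C-to-Z c u (CorY-headKey c u CY) head≤Z
    ... | inj₁ e = e
    ... | inj₂ e = ⊥-elim (<-irrefl e (≤-<-trans (headKey-≤ c) (CY-before-Z cy)))

    new-or-old : ∀ v → WindowMark u P' v → v ≡ 1 ⊎ WindowMark u prev v
    new-or-old v v∈ = Sum.map₁ proj₂ (windowMark-split v∈)

    -- Covering, 1 ∈ D: nothing changes.  The exceptional rule stays disarmed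
    -- because a window mark 1 contradicts g ≥ 2 together with the flags.
    covering-1∈D : ∀ D → (∀ d → d ∈ D → WindowMark u prev d) → Covering u prev D → 1 ∈ D → Covering u P' D
    covering-1∈D D D-window (in-D , disarmed) 1∈D =
      (λ v v∈ → [ (λ { refl → 1∈D }) , in-D v ]′ (new-or-old v v∈)) ,
      (λ _ _ flags 2≤g → ⊥-elim (mark1-disarms (D-window 1 1∈D) flags (subst (2 ≤_) same-g 2≤g)))
      where
      mark1-disarms : WindowMark u prev 1 → Flags u → 2 ≤ gMark u prev → ⊥
      mark1-disarms (windowMark q q∈ w) flags 2≤g with windowPart q 1 q∈ w
      ... | even-part e = <-irrefl refl (≤-trans 2≤g (leastUsed-≤ (evenMarks u prev) 1 (evenMarks-∈⁺ u prev q 1 q∈ e) ≤-refl))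
      ... | X-part refl = flags-no-X c u flags 1 q∈
      ... | CY-part cq  = <-irrefl refl (≤-trans 2≤g (≤-trans
              (disarmed (CorY-headKey c u (traced-CorY 1 cq q∈)) head≤Z flags 2≤g)
              (≤-reflexive (head-mark1 (traced-CorY 1 cq q∈)))))

    -- Covering with 1 ∉ D: the new mark 1 is the only window mark outside D.
    module Uncovered (D : List ℕ) (X-mark1 : 1 ≤ tcount (PX u) prev → WindowMark u prev 1)
                     (in-D : ∀ v → WindowMark u prev v → v ∈ D) (1∉D : 1 ∉ D) where
      in-D-or-1 : ∀ v → WindowMark u P' v → v ∈ D ⊎ v ≡ 1
      in-D-or-1 v v∈ = [ inj₂ , inj₁ ∘ in-D v ]′ (new-or-old v v∈)

      -- an X would have put 1 into D
      no-X : ∀ m → (PX u , m) ∉ prev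
      no-X m X∈ = 1∉D (in-D 1 (X-mark1 (∈⇒tcount-pos (PX u) m prev X∈)))

      flags : Flags u
      flags = CY-occurs cy (current-occurs c) , no-X-in-μ
        where
        no-X-in-μ : occurs (2 * u + 2 ∸ 1 , true) μ ≡ false
        no-X-in-μ rewrite 2u+2∸1 u with occurs (PX u) μ in eq
        ... | false = refl
        ... | true  = let (m , X∈) = occurs-before⇒traced c (PX u) eq (<-≤-trans (X<C u) (CY-after-C cy)) in ⊥-elim (no-X m X∈)

      Z<g : ∀ m → (PZ u , m) ∈ P' → m < gMark u P'
      Z<g m (here e)   = ⊥-elim (CY≢Z cy (sym (cong proj₁ e)))
      Z<g m (there Z∈) = ⊥-elim (<-irrefl refl (<-≤-trans (CY-before-Z cy) (before c _ m Z∈)))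

      -- no part of size 2u yet: the exceptional rule stays unavailable
      unarmed : evenMarks u prev ≡ [] → OneApartNoEven u P' D
      unarmed none = in-D-or-1 , 1∉D , trans (evenMarks-other u prev p 1 (CY-size cy)) none
        , trans (tcount-there (PX u) p 1 prev (CY≢X cy ∘ sym)) (tcount-zero (PX u) prev no-X) , CY-CorY prev 1 cy

      -- some part of size 2u: g ≥ 2 (as 1 ∉ D) and the exceptional rule is armed
      armed : ∀ {e es} → evenMarks u prev ≡ e ∷ es → OneApart u P' D
      armed {e} some = in-D-or-1 , 1∉D , subst (2 ≤_) (sym same-g) 2≤g
        , subst (_∈ D) (sym same-g) g∈D , flags , CY-CorY prev 1 cy , g-1-at-head , Z<g
        where
        e∈ : e ∈ evenMarks u prev
        e∈ = subst (e ∈_) (sym some) (here refl)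
        1≤g : 1 ≤ gMark u prev
        1≤g with evenMarks-∈⁻ u prev e e∈
        ... | q , q∈ , _ = leastUsed-pos (evenMarks u prev) e e∈ (proj₁ (kinds c q e q∈))
        g∈D : gMark u prev ∈ D
        g∈D with leastUsed-0-or-∈ (evenMarks u prev)
        ... | inj₁ g≡0 = ⊥-elim (<-irrefl (sym g≡0) 1≤g)
        ... | inj₂ g∈  = in-D _ (evenMarks-window u prev _ g∈)
        2≤g : 2 ≤ gMark u prev
        2≤g with m≤n⇒m<n∨m≡n 1≤g
        ... | inj₁ 1<g = 1<g
        ... | inj₂ 1≡g = ⊥-elim (1∉D (subst (_∈ D) (sym 1≡g) g∈D))
        -- g - 1 ≥ 1 is not an old window mark: not of a part 2u (g is least),
        -- not of X (there is none), not of C or Y (that would put 1 in D)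
        g-1-at-head : headKey P' ≤ 2 * (2 * u + 2) → ∀ v → WindowMark u P' v → v ≡ gMark u P' ∸ 1 →
                      headMark P' ≡ gMark u P' ∸ 1
        g-1-at-head _ v v∈ v≡ with new-or-old v v∈
        ... | inj₁ v≡1 = trans (sym v≡1) v≡
        ... | inj₂ (windowMark q q∈ w) with windowPart q v q∈ w
        ...   | even-part e = ⊥-elim (<-irrefl refl (≤-<-trans
                  (leastUsed-≤ (evenMarks u prev) v (evenMarks-∈⁺ u prev q v q∈ e) (proj₁ (kinds c q v q∈)))
                  (subst (_< gMark u prev) (sym (trans v≡ (cong (_∸ 1) same-g))) (n∸1<n 1≤g))))
        ...   | X-part refl = ⊥-elim (no-X v q∈)
        ...   | CY-part cq  = ⊥-elim (1∉D (in-D 1 (CorY-mark1 c u (traced-CorY v cq q∈))))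

    covering-1∉D : ∀ D → (1 ≤ tcount (PX u) prev → WindowMark u prev 1) → Covering u prev D → 1 ∉ D →
                   OneApart u P' D ⊎ OneApartNoEven u P' D
    covering-1∉D D X-mark1 (in-D , _) 1∉D = by-evenMarks (evenMarks u prev) refl
      where
      open Uncovered D X-mark1 in-D 1∉D
      by-evenMarks : ∀ l → evenMarks u prev ≡ l → OneApart u P' D ⊎ OneApartNoEven u P' D
      by-evenMarks []      none = inj₂ (unarmed none)
      by-evenMarks (_ ∷ _) some = inj₁ (armed some)

    oneApart : ∀ D → OneApart u prev D → OneApart u P' D
    oneApart D (in-D-or-1 , 1∉D , 2≤g , g∈D , flags , CY , g-1-at-head , Z<g) =
      (λ v v∈ → [ inj₂ , in-D-or-1 v ]′ (new-or-old v v∈)) , 1∉D , subst (2 ≤_) (sym same-g) 2≤g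
      , subst (_∈ D) (sym same-g) g∈D , flags , CorY-there u prev p 1 CY , g-1-at-head' , Z<g'
      where
      g-1-at-head' : headKey P' ≤ 2 * (2 * u + 2) → ∀ v → WindowMark u P' v → v ≡ gMark u P' ∸ 1 →
                     headMark P' ≡ gMark u P' ∸ 1
      g-1-at-head' _ v v∈ v≡ with new-or-old v v∈
      ... | inj₁ v≡1 = trans (sym v≡1) v≡
      ... | inj₂ old = trans (sym (head-mark1 CY))
                         (trans (g-1-at-head head≤Z v old (trans v≡ (cong (_∸ 1) same-g))) (cong (_∸ 1) (sym same-g)))
      Z<g' : ∀ m → (PZ u , m) ∈ P' → m < gMark u P'
      Z<g' m (here e)   = ⊥-elim (CY≢Z cy (sym (cong proj₁ e)))
      Z<g' m (there Z∈) = ⊥-elim (<-irrefl refl (<-≤-trans (CY-before-Z cy) (before c _ m Z∈)))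

    oneApartNoEven : ∀ D → OneApartNoEven u prev D → OneApartNoEven u P' D
    oneApartNoEven D (in-D-or-1 , 1∉D , no-even , no-X , CY) =
      (λ v v∈ → [ inj₂ , in-D-or-1 v ]′ (new-or-old v v∈)) , 1∉D
      , trans (evenMarks-other u prev p 1 (CY-size cy)) no-even
      , trans (tcount-there (PX u) p 1 prev (CY≢X cy ∘ sym)) no-X , CorY-there u prev p 1 CY

  inv-CY : ∀ {prev ps u p} → Stage prev p ps → IsCY u p → Inv u prev →
           OddWitness u ((p , 1) ∷ prev) → Inv u ((p , 1) ∷ prev)
  inv-CY {prev} {ps} {u} {p} c cy (mkInv D D-unique D-window D-length mode Z-covers X-mark1 C-witness) C-witness' =
    mkInv D D-unique (λ d d∈ → windowMark-there (D-window d d∈))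
      (trans D-length (sym (windowCount-other u prev p 1 (CY≢ū cy) (CY≢U cy) (CY≢X cy) (CY≢Z cy)))) (mode' mode)
      (λ e → ⊥-elim (<-irrefl e (CY-before-Z cy)))
      (X-mark1-other u prev p 1 (CY≢X cy) X-mark1) C-witness'
    where
    open CorYStep c cy
    mode' : Covering u prev D ⊎ OneApart u prev D ⊎ OneApartNoEven u prev D →
            Covering u P' D ⊎ OneApart u P' D ⊎ OneApartNoEven u P' D
    mode' (inj₁ cover) with 1 ∈? D
    ... | yes 1∈D = inj₁ (covering-1∈D D D-window cover 1∈D)
    ... | no 1∉D  = inj₂ (covering-1∉D D X-mark1 cover 1∉D)
    mode' (inj₂ (inj₁ apart))  = inj₂ (inj₁ (oneApart D apart))
    mode' (inj₂ (inj₂ apart₀)) = inj₂ (inj₂ (oneApartNoEven D apart₀))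

  -- For a C, the list [1] is a witness, since no Z precedes C.
  C-witness-C : ∀ {prev ps u} → Stage prev (PC u) ps → OddWitness u ((PC u , 1) ∷ prev)
  C-witness-C {prev} {ps} {u} c _ =
    (1 ∷ []) , ((λ ()) ∷ᵘ []) , (λ { d (here refl) → windowMark-here (<⇒≤ (<01 u) , <⇒≤ (<12 u)) })
    , cong (_+ 1) (sym no-Z) , (λ { d (here refl) → inj₁ refl })
    where
    no-Z : tcount (PZ u) ((PC u , 1) ∷ prev) ≡ 0
    no-Z = trans (tcount-there (PZ u) (PC u) 1 prev (size-≢ (≢12 u ∘ sym)))
                 (tcount-zero (PZ u) prev (λ m Z∈ → <-irrefl refl (<-≤-trans (C<Z u) (before c _ m Z∈))))

  -- Besides the invariant, the step for Z = 2u+2 yields a bound on its mark m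
  -- (used in the forward direction): m is at most the window count, or an
  -- earlier mark, or f_{2u+2} + 1 after a C or Y ...
  ZBound : ℕ → Trace → ℕ → Set
  ZBound u prev m = (m ≤ windowCount u ((PZ u , m) ∷ prev))
                  ⊎ (Σ Part λ q → Σ ℕ λ m' → (q , m') ∈ prev × m ≤ m')
                  ⊎ (m ≤ tcount (PZ u) ((PZ u , m) ∷ prev) + 1 × CorY u prev)

  -- ... and m is not the mark of an earlier part of size 2u+2 (needed by inv-U).
  NewAtSize : ℕ → Trace → ℕ → Set
  NewAtSize u prev m = ∀ q → (q , m) ∈ prev → size q ≢ 2 * u + 2

  ZResult : ℕ → Trace → ℕ → Set
  ZResult u prev m = Inv u ((PZ u , m) ∷ prev) × ZBound u prev m × NewAtSize u prev m

  module ZStep {prev ps u} (c : Stage prev (PZ u) ps) (I : Inv u prev) where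
    open Inv I

    Z∈W : InWindow u (PZ u)
    Z∈W = <⇒≤ (<02 u) , ≤-refl

    head≤Z : headKey prev ≤ key (PZ u)
    head≤Z = headKey-≤ c

    same-g : ∀ m → gMark u ((PZ u , m) ∷ prev) ≡ gMark u prev
    same-g m = gMark-other u prev (PZ u) m (≢02 u ∘ sym)

    count-suc : ∀ m → suc (length D) ≡ windowCount u ((PZ u , m) ∷ prev)
    count-suc m = trans (cong suc D-length) (sym (windowCount-Z u prev m))

    X-mark1' : ∀ m → 1 ≤ tcount (PX u) ((PZ u , m) ∷ prev) → WindowMark u ((PZ u , m) ∷ prev) 1
    X-mark1' m = X-mark1-other u prev (PZ u) m (overlined-≢ false≢true) X-mark1

    witness-Z : ∀ m → (∀ d → WindowMark u prev d → d ≡ 1 ⊎ (PZ u , d) ∈ prev → d ≢ m) →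
                OddWitness u ((PZ u , m) ∷ prev)
    witness-Z m new C∈ with C-witness (subst (1 ≤_) (tcount-there (PC u) (PZ u) m prev (size-≢ (≢12 u))) C∈)
    ... | D₂ , D₂-unique , D₂-window , D₂-length , D₂-marks =
      (m ∷ D₂) , ((λ m∈ → new m (D₂-window m m∈) (D₂-marks m m∈) refl) ∷ᵘ D₂-unique) , D₂'-window
      , trans (cong suc D₂-length) (sym (cong (_+ 1) (tcount-here (PZ u) m prev))) , D₂'-marks
      where
      D₂'-window : ∀ d → d ∈ m ∷ D₂ → WindowMark u ((PZ u , m) ∷ prev) d
      D₂'-window d (here refl) = windowMark-here Z∈W
      D₂'-window d (there d∈)  = windowMark-there (D₂-window d d∈)
      D₂'-marks : ∀ d → d ∈ m ∷ D₂ → d ≡ 1 ⊎ (PZ u , d) ∈ ((PZ u , m) ∷ prev)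
      D₂'-marks d (here refl) = inj₂ (here refl)
      D₂'-marks d (there d∈)  = Sum.map₂ there (D₂-marks d d∈)

    -- Rule (d), exceptional case: Z gets g.  Then the mark 1 of a C or Y joins D,
    -- and the window marks are covered again.
    module Exceptional (2≤g : 2 ≤ gMark u prev) (head≡ : headMark prev ≡ gMark u prev ∸ 1) (flags : Flags u) where
      g : ℕ
      g = gMark u prev
      P' : Trace
      P' = (PZ u , g) ∷ prev

      CY : CorY u prev
      CY = flags-CorY c u flags (Y<Z u)

      C≤head : key (PC u) ≤ headKey prev
      C≤head = CorY-headKey c u CY

      -- Only OneApart is possible: in Covering g ≤ headMark = g - 1, in OneApartNoEven g = 0.
      apart : OneApart u prev D
      apart with mode
      ... | inj₁ (_ , disarmed) = ⊥-elim (<-irrefl refl (<-≤-trans (n∸1<n (≤-trans (s≤s z≤n) 2≤g))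
                                    (≤-trans (disarmed C≤head head≤Z flags 2≤g) (≤-reflexive head≡))))
      ... | inj₂ (inj₁ a) = a
      ... | inj₂ (inj₂ (_ , _ , no-even , _ , _)) = ⊥-elim (n≮0 (subst (2 ≤_) (cong leastUsed no-even) 2≤g))

      result : ZResult u prev g
      result with apart
      ... | in-D-or-1 , 1∉D , _ , g∈D , _ , _ , _ , Z<g =
        mkInv (1 ∷ D) (1∉D ∷ᵘ D-unique) D'-window (count-suc g)
          (inj₁ (all-in-D' , λ _ _ _ _ → ≤-reflexive (same-g g))) covers (X-mark1' g) (witness-Z g g-new)
        , inj₂ (inj₁ g-earlier) , new-at-size
        where
        D'-window : ∀ d → d ∈ 1 ∷ D → WindowMark u P' d
        D'-window d (here refl) = windowMark-there (CorY-mark1 c u CY)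
        D'-window d (there d∈)  = windowMark-there (D-window d d∈)
        all-in-D' : ∀ v → WindowMark u P' v → v ∈ 1 ∷ D
        all-in-D' v v∈ with windowMark-split v∈
        ... | inj₁ (_ , refl) = there g∈D
        ... | inj₂ old = [ there , (λ { refl → here refl }) ]′ (in-D-or-1 v old)
        -- the head has mark g - 1; it is a C or Y (then g = 2) or a Z (then use Z-covers)
        covers : headKey P' ≡ 2 * (2 * u + 2) → ∀ v → 1 ≤ v → v ≤ headMark P' → WindowMark u P' v
        covers _ v 1≤v v≤g with m≤n⇒m<n∨m≡n v≤g
        ... | inj₂ refl = windowMark-here Z∈W
        ... | inj₁ v<g with head-C-to-Z c u C≤head head≤Z
        ...   | inj₁ head≡1 = subst (WindowMark u P')
                  (≤-antisym 1≤v (≤-trans (<⇒≤∸1 v<g) (≤-reflexive (trans (sym head≡) head≡1))))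
                  (windowMark-there (CorY-mark1 c u CY))
        ...   | inj₂ head≡Z = windowMark-there (Z-covers head≡Z v 1≤v (≤-trans (<⇒≤∸1 v<g) (≤-reflexive (sym head≡))))
        g-new : ∀ d → WindowMark u prev d → d ≡ 1 ⊎ (PZ u , d) ∈ prev → d ≢ g
        g-new d _ (inj₁ d≡1) d≡g = 2≤⇒≢1 2≤g (trans (sym d≡g) d≡1)
        g-new d _ (inj₂ Z∈) d≡g  = <-irrefl d≡g (Z<g d Z∈)
        g-earlier : Σ Part λ q → Σ ℕ λ m' → (q , m') ∈ prev × g ≤ m'
        g-earlier with D-window g g∈D
        ... | windowMark q q∈ _ = q , g , q∈ , ≤-refl
        new-at-size : NewAtSize u prev g
        new-at-size (s , true)  q∈ refl = 2≤⇒≢1 2≤g (Y-mark1 u g (kinds c _ g q∈))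
        new-at-size (s , false) q∈ refl = <-irrefl refl (Z<g g q∈)

    -- Rule (d), regular case: Z gets f, the least positive number that is not a
    -- window mark; it joins D.
    module Regular (regular : exceptional μ prev (2 * u + 2) ≡ false) where
      L : List ℕ
      L = rangeMarks (2 * u + 2) prev
      m : ℕ
      m = leastUnused L
      P' : Trace
      P' = (PZ u , m) ∷ prev

      1≤m : 1 ≤ m
      1≤m = leastUnused-pos L

      m-new : ¬ WindowMark u prev m
      m-new v∈ = leastUnused-∉ L (window-rangeMarks u prev m v∈)

      below-m : ∀ v → 1 ≤ v → v < m → WindowMark u prev v
      below-m v 1≤v v<m = rangeMarks-window u prev v (leastUnused-below L v 1≤v v<m) (traced-size-≤ c)

      not-exceptional : 2 ≤ gMark u prev → headMark prev ≡ gMark u prev ∸ 1 → Flags u → ⊥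
      not-exceptional 2≤g head≡ flags with trans (sym regular) (exceptional⇐ u prev 2≤g head≡ flags)
      ... | ()

      D'-window : ∀ d → d ∈ m ∷ D → WindowMark u P' d
      D'-window d (here refl) = windowMark-here Z∈W
      D'-window d (there d∈)  = windowMark-there (D-window d d∈)

      covers : headKey P' ≡ 2 * (2 * u + 2) → ∀ v → 1 ≤ v → v ≤ headMark P' → WindowMark u P' v
      covers _ v 1≤v v≤m with m≤n⇒m<n∨m≡n v≤m
      ... | inj₂ refl = windowMark-here Z∈W
      ... | inj₁ v<m  = windowMark-there (below-m v 1≤v v<m)

      new-at-size : NewAtSize u prev m
      new-at-size q q∈ e = m-new (windowMark q q∈ (≤-trans (<⇒≤ (<02 u)) (≤-reflexive (sym e)) , ≤-reflexive e))

      inv : Covering u P' (m ∷ D) ⊎ OneApart u P' (m ∷ D) ⊎ OneApartNoEven u P' (m ∷ D) → Inv u P'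
      inv mode' = mkInv (m ∷ D) ((m-new ∘ D-window m) ∷ᵘ D-unique) D'-window (count-suc m) mode' covers (X-mark1' m)
                    (witness-Z m (λ d d∈ _ d≡m → m-new (subst (WindowMark u prev) d≡m d∈)))

      in-D'-or-1 : (∀ v → WindowMark u prev v → v ∈ D ⊎ v ≡ 1) → ∀ v → WindowMark u P' v → v ∈ m ∷ D ⊎ v ≡ 1
      in-D'-or-1 in-D-or-1 v v∈ with windowMark-split v∈
      ... | inj₁ (_ , refl) = inj₁ (here refl)
      ... | inj₂ old = Sum.map₁ there (in-D-or-1 v old)

      -- after a C or Y, 1 is a window mark, so m ≠ 1
      1∉D' : CorY u prev → 1 ∉ D → 1 ∉ m ∷ D
      1∉D' CY 1∉D (here 1≡m) = m-new (subst (WindowMark u prev) 1≡m (CorY-mark1 c u CY))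
      1∉D' CY 1∉D (there 1∈) = 1∉D 1∈

      from-covering : Covering u prev D → ZResult u prev m
      from-covering (in-D , disarmed) = inv (inj₁ (all-in-D' , disarmed')) , inj₁ bound , new-at-size
        where
        all-in-D' : ∀ v → WindowMark u P' v → v ∈ m ∷ D
        all-in-D' v v∈ = [ (λ { (_ , refl) → here refl }) , there ∘ in-D v ]′ (windowMark-split v∈)
        bound : m ≤ windowCount u P'
        bound = subst (m ≤_) (count-suc m) (covering-below m D 1≤m (λ v 1≤v v<m → in-D v (below-m v 1≤v v<m)))
        -- the head is a C or Y (marked 1, impossible for g ≥ 2) or a Z, whose mark is below m
        disarmed' : 2 * (2 * u + 1) ≤ headKey P' → headKey P' ≤ 2 * (2 * u + 2) → Flags u → 2 ≤ gMark u P' →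
                    gMark u P' ≤ headMark P'
        disarmed' _ _ flags 2≤g' with head-C-to-Z c u (CorY-headKey c u (flags-CorY c u flags (Y<Z u))) head≤Z
        ... | inj₁ head≡1 = ⊥-elim (2≤⇒≢1 2≤g (≤-antisym (≤-trans g≤head (≤-reflexive head≡1)) (≤-trans (s≤s z≤n) 2≤g)))
          where
          2≤g = subst (2 ≤_) (same-g m) 2≤g'
          g≤head = disarmed (CorY-headKey c u (flags-CorY c u flags (Y<Z u))) head≤Z flags 2≤g
        ... | inj₂ head≡Z = ≤-trans (≤-reflexive (same-g m)) (≤-trans g≤head (<⇒≤ head<m))
          where
          2≤g = subst (2 ≤_) (same-g m) 2≤g'
          g≤head = disarmed (CorY-headKey c u (flags-CorY c u flags (Y<Z u))) head≤Z flags 2≤g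
          head<m : headMark prev < m
          head<m = ≰⇒> (λ m≤head → m-new (Z-covers head≡Z m 1≤m m≤head))

      from-oneApart : OneApart u prev D → ZResult u prev m
      from-oneApart (in-D-or-1 , 1∉D , 2≤g , g∈D , flags , CY , g-1-at-head , Z<g) =
        inv (inj₂ (inj₁ (in-D'-or-1 in-D-or-1 , 1∉D' CY 1∉D , subst (2 ≤_) (sym (same-g m)) 2≤g
                        , subst (_∈ m ∷ D) (sym (same-g m)) (there g∈D) , flags , CorY-there u prev (PZ u) m CY
                        , g-1-at-head' , Z<g')))
        , inj₂ (inj₁ m-earlier) , new-at-size
        where
        g = gMark u prev
        head≢g-1 : headMark prev ≢ g ∸ 1
        head≢g-1 head≡ = not-exceptional 2≤g head≡ flags
        -- m ≠ g since g is a window mark; m > g would make g - 1 a window mark,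
        -- hence the head mark, and the exceptional rule would have applied
        m<g : m < g
        m<g with <-cmp m g
        ... | tri< m<g _ _ = m<g
        ... | tri≈ _ m≡g _ = ⊥-elim (m-new (subst (WindowMark u prev) (sym m≡g) (D-window g g∈D)))
        ... | tri> _ _ m>g = ⊥-elim (head≢g-1 (g-1-at-head head≤Z (g ∸ 1)
                (below-m (g ∸ 1) (∸-monoˡ-≤ 1 2≤g) (≤-<-trans (m∸n≤m g 1) m>g)) refl))
        g-1-at-head' : headKey P' ≤ 2 * (2 * u + 2) → ∀ v → WindowMark u P' v → v ≡ gMark u P' ∸ 1 →
                       headMark P' ≡ gMark u P' ∸ 1
        g-1-at-head' _ v v∈ v≡ with windowMark-split v∈
        ... | inj₁ (_ , refl) = v≡
        ... | inj₂ old = ⊥-elim (head≢g-1 (g-1-at-head head≤Z v old (trans v≡ (cong (_∸ 1) (same-g m)))))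
        Z<g' : ∀ m' → (PZ u , m') ∈ P' → m' < gMark u P'
        Z<g' m' (here refl) = subst (m <_) (sym (same-g m)) m<g
        Z<g' m' (there Z∈)  = subst (m' <_) (sym (same-g m)) (Z<g m' Z∈)
        m-earlier : Σ Part λ q → Σ ℕ λ m' → (q , m') ∈ prev × m ≤ m'
        m-earlier with D-window g g∈D
        ... | windowMark q q∈ _ = q , g , q∈ , <⇒≤ m<g

      from-oneApartNoEven : OneApartNoEven u prev D → ZResult u prev m
      from-oneApartNoEven (in-D-or-1 , 1∉D , no-even , no-X , CY) =
        inv (inj₂ (inj₂ (in-D'-or-1 in-D-or-1 , 1∉D' CY 1∉D
                        , trans (evenMarks-other u prev (PZ u) m (≢02 u ∘ sym)) no-even
                        , trans (tcount-there (PX u) (PZ u) m prev (overlined-≢ true≢false)) no-X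
                        , CorY-there u prev (PZ u) m CY)))
        , inj₂ (inj₂ (bound , CY)) , new-at-size
        where
        -- no ū, U or X was traced, so the window count is the number of Z
        absent : ∀ b → tcount (2 * u , b) prev ≡ 0
        absent b = tcount-zero _ prev (λ m' q∈ → ∉[] (subst (m' ∈_) no-even (evenMarks-∈⁺ u prev _ m' q∈ refl)))
        count≡Z : windowCount u prev ≡ tcount (PZ u) prev
        count≡Z rewrite absent true | absent false | no-X = refl
        bound : m ≤ tcount (PZ u) P' + 1
        bound = begin
          m                                ≤⟨ covering-below m (1 ∷ D) 1≤m (λ v 1≤v v<m →
                                                [ there , (λ { refl → here refl }) ]′ (in-D-or-1 v (below-m v 1≤v v<m))) ⟩
          suc (suc (length D))             ≡⟨ cong (suc ∘ suc) (trans D-length count≡Z) ⟩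
          suc (suc (tcount (PZ u) prev))   ≡⟨ sym (+-comm (suc (tcount (PZ u) prev)) 1) ⟩
          suc (tcount (PZ u) prev) + 1     ≡⟨ cong (_+ 1) (sym (tcount-here (PZ u) m prev)) ⟩
          tcount (PZ u) P' + 1             ∎
          where open ≤-Reasoning

  inv-Z : ∀ {prev ps u} → Stage prev (PZ u) ps → Inv u prev → ZResult u prev (markOf μ prev (PZ u))
  inv-Z {prev} {ps} {u} c I rewrite mark-evenPlain μ prev (2 * u + 2) (isEven-2*+2 u)
    with exceptional μ prev (2 * u + 2) in exc
  ... | true  = let (2≤g , head≡ , flags) = exceptional⇒ u prev exc in ZStep.Exceptional.result c I 2≤g head≡ flags
  ... | false = [ from-covering , [ from-oneApart , from-oneApartNoEven ]′ ]′ (Inv.mode I)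
    where open ZStep.Regular c I exc

  inv-U' : ∀ {prev ps u s} → s ≡ 2 * u → Stage prev (s , false) ps → ∀ m →
           (∀ q → (q , m) ∈ prev → size q ≢ s) → Inv u prev → Inv u (((s , false) , m) ∷ prev)
  inv-U' refl = inv-U

  Z-new-at-size : ∀ {prev ps u s} → s ≡ 2 * u + 2 → Stage prev (s , false) ps → Inv u prev →
                  ∀ q → (q , markOf μ prev (s , false)) ∈ prev → size q ≢ s
  Z-new-at-size refl c I = proj₂ (proj₂ (inv-Z c I))

  inv-step : ∀ {prev p ps} → Stage prev p ps → (∀ u → Inv u prev) → ∀ u → Inv u ((p , markOf μ prev p) ∷ prev)
  inv-step {prev} {p} {ps} c I u with position u p
  ... | below p< = inv-below u _ small
    where
    small : ∀ q m → (q , m) ∈ ((p , markOf μ prev p) ∷ prev) → size q < 2 * u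
    small q m (here refl) = p<
    small q m (there q∈)  = ≤-<-trans (traced-size-≤ c q m q∈) p<
  ... | isū = inv-ū c
  ... | isX = proj₁ (inv-X c (I u))
  ... | isC rewrite mark-oddPlain μ prev (2 * u + 1) (isEven-2*+1 u) = inv-CY c C-part (I u) (C-witness-C c)
  ... | isY rewrite mark-evenBar μ prev (2 * u + 2) (isEven-2*+2 u) =
    inv-CY c Y-part (I u) (C-witness-other u prev (PY u) 1 (size-≢ (≢12 u ∘ sym)) (overlined-≢ true≢false) (Inv.C-witness (I u)))
  ... | isZ = proj₁ (inv-Z c (I u))
  ... | above p> = inv-above u prev p _ p> (I u)
  ... | isU with u
  ...   | zero   = ⊥-elim (<-irrefl refl (current-pos c))
  ...   | suc u' = inv-U' refl c _ (Z-new-at-size (sym (2u+2≡2*suc u')) c (I u')) (I (suc u'))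

  stage-start : ∀ {p ps} → p ∷ ps ≡ μ → Stage [] p ps
  stage-start e = record { rebuilds = e ; before = λ _ _ () ; below-head = λ _ _ () ; kinds = λ _ _ () }

  stage-next : ∀ {prev p p' ps} → Stage prev p (p' ∷ ps) → Stage ((p , markOf μ prev p) ∷ prev) p' ps
  stage-next {prev} {p} c = record
    { rebuilds   = rebuilds c
    ; before     = λ { q m (here refl) → next-key-≥ c refl ; q m (there q∈) → ≤-trans (before c q m q∈) (next-key-≥ c refl) }
    ; below-head = λ { q m (here refl) → ≤-refl ; q m (there q∈) → before c q m q∈ }
    ; kinds      = λ { q m (here refl) → kind-new μ prev p ; q m (there q∈) → kinds c q m q∈ } }

  inv-start : ∀ u → Inv u []
  inv-start u = inv-below u [] (λ _ _ ())

  windowSize : ℕ → ℕ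
  windowSize t = f̄ (2 * t) μ + f (2 * t) μ + f̄ (2 * t + 1) μ + f (2 * t + 2) μ

  windowCount-≤ : ∀ {prev p ps} → Stage prev p ps → ∀ u m → windowCount u ((p , m) ∷ prev) ≤ windowSize u
  windowCount-≤ c u m = +-mono-≤ (+-mono-≤ (+-mono-≤ (tcount-≤-count c _ m) (tcount-≤-count c _ m))
                                           (tcount-≤-count c _ m)) (tcount-≤-count c _ m)

  tcount-prev-≤ : ∀ {prev p ps} → Stage prev p ps → ∀ a → tcount a prev ≤ count a μ
  tcount-prev-≤ {prev} {p} c a = ≤-trans (tcount-mono a prev p 0) (tcount-≤-count c a 0)

  current-count-pos : ∀ {prev p ps} → Stage prev p ps → 1 ≤ count p μ
  current-count-pos c = ∈⇒count-pos _ μ (current-∈μ c)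

  module Forward (k : ℕ) (cond2 : ∀ t → windowSize t + 1 ≤ k)
                 (cond3 : ∀ t → 1 ≤ f (2 * t + 1) μ → f (2 * t + 2) μ + 2 ≤ k) where

    Bounded : Trace → Set
    Bounded P = ∀ q m → (q , m) ∈ P → m + 1 ≤ k

    -- A Z: each alternative of ZBound is bounded by (2), by an earlier mark,
    -- by (3) (after a C), or by (2) for the next window (after a Y = ū of u + 1).
    mark-bound-Z : ∀ {prev ps u} → Stage prev (PZ u) ps → (∀ u → Inv u prev) → Bounded prev →
                   markOf μ prev (PZ u) + 1 ≤ k
    mark-bound-Z {prev} {ps} {u} c I bounded with proj₁ (proj₂ (inv-Z {u = u} c (I u)))
    ... | inj₁ m≤count = ≤-trans (+-monoˡ-≤ 1 (≤-trans m≤count (windowCount-≤ c u (markOf μ prev (PZ u))))) (cond2 u)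
    ... | inj₂ (inj₁ (q , m' , q∈ , m≤m')) = ≤-trans (+-monoˡ-≤ 1 m≤m') (bounded q m' q∈)
    ... | inj₂ (inj₂ (m≤Z+1 , inj₁ C∈)) =
      ≤+1-bound (≤-trans m≤Z+1 (+-monoˡ-≤ 1 (tcount-≤-count c (PZ u) (markOf μ prev (PZ u))))) (cond3 u (≤-trans C∈ (tcount-prev-≤ c (PC u))))
    ... | inj₂ (inj₂ (m≤Z+1 , inj₂ Y∈)) =
      ≤+1-bound (≤-trans m≤Z+1 (+-monoˡ-≤ 1 (tcount-≤-count c (PZ u) (markOf μ prev (PZ u)))))
        (window-second-bound (subst (λ z → f̄ z μ + f z μ + f̄ (z + 1) μ + f (z + 2) μ + 1 ≤ k) (sym (2u+2≡2*suc u)) (cond2 (suc u)))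
                             (≤-trans Y∈ (tcount-prev-≤ c (PY u))))

    mark-bound-Z' : ∀ {prev ps u s} → s ≡ 2 * u + 2 → Stage prev (s , false) ps → (∀ u → Inv u prev) →
                    Bounded prev → markOf μ prev (s , false) + 1 ≤ k
    mark-bound-Z' {u = u} refl = mark-bound-Z {u = u}

    mark-bound : ∀ {prev p ps} → Stage prev p ps → (∀ u → Inv u prev) → Bounded prev → markOf μ prev p + 1 ≤ k
    mark-bound {prev} {s , b} c I bounded with parity s
    -- ū is marked 1, and (2) with f_{2̄t} ≥ 1 gives k ≥ 2
    mark-bound {prev} {s , true} c I bounded | t , inj₁ refl rewrite mark-evenBar μ prev (2 * t) (isEven-2* t) =
      +2≤⇒2≤ (window-second-bound (cond2 t) (current-count-pos c))
    -- C is marked 1, and (3) gives k ≥ 2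
    mark-bound {prev} {s , false} c I bounded | t , inj₂ refl rewrite mark-oddPlain μ prev (2 * t + 1) (isEven-2*+1 t) =
      +2≤⇒2≤ (cond3 t (current-count-pos c))
    -- X: its mark is at most the window count
    mark-bound {prev} {s , true} c I bounded | t , inj₂ refl =
      ≤-trans (+-monoˡ-≤ 1 (≤-trans (proj₂ (inv-X {u = t} c (I t))) (windowCount-≤ c t (markOf μ prev (PX t))))) (cond2 t)
    mark-bound {prev} {s , false} c I bounded | zero , inj₁ refl = ⊥-elim (<-irrefl refl (current-pos c))
    mark-bound {prev} {s , false} c I bounded | suc u , inj₁ refl = mark-bound-Z' {u = u} (sym (2u+2≡2*suc u)) c I bounded

    marks-bounded-from : ∀ prev p ps → Stage prev p ps → (∀ u → Inv u prev) → Bounded prev →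
                         All (λ m → m + 1 ≤ k) (markGo μ prev (p ∷ ps))
    marks-bounded-from prev p []        c I bounded = mark-bound c I bounded ∷ []
    marks-bounded-from prev p (p' ∷ ps) c I bounded =
      mark-bound c I bounded ∷ marks-bounded-from _ p' ps (stage-next c) (inv-step c I) bounded'
      where
      bounded' : Bounded ((p , markOf μ prev p) ∷ prev)
      bounded' q m (here refl) = mark-bound c I bounded
      bounded' q m (there q∈)  = bounded q m q∈

    marks-bounded : All (λ m → m + 1 ≤ k) (marks μ)
    marks-bounded = from μ refl
      where
      from : ∀ ν → ν ≡ μ → All (λ m → m + 1 ≤ k) (markGo μ [] ν)
      from []       _ = []
      from (p ∷ ps) e = marks-bounded-from [] p ps (stage-start e) inv-start (λ _ _ ())

  -- Backward direction: run the marking to its end, keeping the invariants,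
  -- then apply the pigeonhole principle to the lists of distinct marks.
  MarksIn : ℕ → Trace → Set
  MarksIn k P = ∀ q m → (q , m) ∈ P → 1 ≤ m × m + 1 ≤ k

  Complete : ℕ → Set
  Complete k = Σ Trace λ P → rebuild P [] ≡ μ × (∀ u → Inv u P) × MarksIn k P

  complete-from : ∀ k prev p ps → Stage prev p ps → (∀ u → Inv u prev) → (∀ q m → (q , m) ∈ prev → m + 1 ≤ k) →
                  All (λ m → m + 1 ≤ k) (markGo μ prev (p ∷ ps)) → Complete k
  complete-from k prev p [] c I bounded (p-bound ∷ []) =
    ((p , markOf μ prev p) ∷ prev) , rebuilds c , inv-step c I , marks-in
    where
    marks-in : MarksIn k ((p , markOf μ prev p) ∷ prev)
    marks-in q m (here refl) = mark-pos μ prev p , p-bound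
    marks-in q m (there q∈)  = proj₁ (kinds c q m q∈) , bounded q m q∈
  complete-from k prev p (p' ∷ ps) c I bounded (p-bound ∷ rest) =
    complete-from k _ p' ps (stage-next c) (inv-step c I) bounded' rest
    where
    bounded' : ∀ q m → (q , m) ∈ ((p , markOf μ prev p) ∷ prev) → m + 1 ≤ k
    bounded' q m (here refl) = p-bound
    bounded' q m (there q∈)  = bounded q m q∈

  complete : ∀ k → All (λ m → m + 1 ≤ k) (marks μ) → Complete k
  complete k = from μ refl
    where
    from : ∀ ν → ν ≡ μ → All (λ m → m + 1 ≤ k) (markGo μ [] ν) → Complete k
    from []       e _       = [] , e , inv-start , (λ _ _ ())
    from (p ∷ ps) e bounded = complete-from k [] p ps (stage-start e) inv-start (λ _ _ ()) bounded

  conditions-from-complete : ∀ n → Complete (suc n) →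
    (∀ t → windowSize t + 1 ≤ suc n) × (∀ t → 1 ≤ f (2 * t + 1) μ → f (2 * t + 2) μ + 2 ≤ suc n)
  conditions-from-complete n (P , done , I , marks-in) = cond2 , cond3
    where
    counts : ∀ a → tcount a P ≡ count a μ
    counts a = trans (sym (+-identityʳ _)) (trans (sym (count-rebuild a P [])) (cong (count a) done))
    in-range : ∀ u d → WindowMark u P d → 1 ≤ d × d ≤ n
    in-range u d (windowMark q q∈ _) = proj₁ (marks-in q d q∈) , +1≤suc⇒≤ (proj₂ (marks-in q d q∈))
    cond2 : ∀ t → windowSize t + 1 ≤ suc n
    cond2 t = ≤⇒+1≤suc (begin
      windowSize t          ≡⟨ sym (cong₄ counts) ⟩
      windowCount t P       ≡⟨ sym D-length ⟩
      length D              ≤⟨ pigeonhole n D D-unique (λ v v∈ → in-range t v (D-window v v∈)) ⟩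
      n                     ∎)
      where
      open Inv (I t)
      open ≤-Reasoning
      cong₄ : (∀ a → tcount a P ≡ count a μ) → windowCount t P ≡ windowSize t
      cong₄ eq rewrite eq (Pū t) | eq (PU t) | eq (PX t) | eq (PZ t) = refl
    cond3 : ∀ t → 1 ≤ f (2 * t + 1) μ → f (2 * t + 2) μ + 2 ≤ suc n
    cond3 t C∈ with Inv.C-witness (I t) (subst (1 ≤_) (sym (counts (PC t))) C∈)
    ... | D₂ , D₂-unique , D₂-window , D₂-length , _ = begin
      f (2 * t + 2) μ + 2         ≡⟨ +-suc (f (2 * t + 2) μ) 1 ⟩
      suc (f (2 * t + 2) μ + 1)   ≡⟨ cong (λ z → suc (z + 1)) (sym (counts (PZ t))) ⟩
      suc (tcount (PZ t) P + 1)   ≡⟨ cong suc (sym D₂-length) ⟩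
      suc (length D₂)             ≤⟨ s≤s (pigeonhole n D₂ D₂-unique (λ v v∈ → in-range t v (D₂-window v v∈))) ⟩
      suc n                       ∎
      where open ≤-Reasoning

proposition3p2 : (k i : ℕ) → 1 ≤ i → i ≤ k → (μ : List Part) → IsOverpartition μ →
    (CountedO k i μ ⇔ ((f̄ 1 μ + f 2 μ + 1 ≤ i) × All (λ m → m + 1 ≤ k) (marks μ)))
proposition3p2 zero i 1≤i i≤k μ ov with ≤-trans 1≤i i≤k
... | ()
proposition3p2 (suc n) i 1≤i i≤k μ ov = mk⇔
  (λ (cond1 , cond2 , cond3) → cond1 , Forward.marks-bounded (suc n) cond2 cond3)
  (λ (cond1 , bounded) → cond1 , conditions-from-complete n (complete (suc n) bounded))
  where open Marking μ ov
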